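{- Let $a,b$ be distinct positive integers, let $\theta=[0;1+d_1,d_2,d_3,\ldots]$ be an irrational number in $(0,1)$ with $d_1\ge1$, let $q_k$ ($k\ge0$) be the denominators of the convergents of $\theta$, and let $\mathbf s$ be a Sturmian word over $\{a,b\}$ of slope $\theta$. Define finite words $M_{ -1}=b$, $M_0=a$, $M_n=M_{n-1}^{d_n}M_{n-2}$ for $n\ge1$. Let $k\ge0$ and let $M$ be a factor of $\mathbf s$ of length $n$ with $q_k\le n\le q_{k+1}-1$. Then either (a) $M$ is a factor of $M_k^{j}M_{k-1}$ for some positive integer $j$, or (b) $M=UV$, where $U$ is a suffix of $M_{k+1}$ and $V$ is a prefix of $M_{k+1}$ with $|V|\ge q_k-1$.
   Context: A Sturmian word over $\{a,b\}$ of slope $\theta$ (irrational in $[0,1]$) is a mechanical word $\mathbf s_{\theta,\rho}=(s_n)_{n\ge1}$ or $\mathbf s'_{\theta,\rho}=(s'_n)_{n\ge1}$ with $0\le\rho<1$, where $s_n=a$ if $\lfloor n\theta+\rho\rfloor-\lfloor (n-1)\theta+\rho\rfloor=0$ and $s_n=b$ otherwise, and $s'_n=a$ if $\lceil n\theta+\rho\rceil-\lceil (n-1)\theta+\rho\rceil=0$ and $s'_n=b$ otherwise. For a finite word $M$, $|M|$ denotes its length; $M^j$ denotes concatenation of $j$ copies. With $\theta=[0;1+d_1,d_2,\ldots]$, its convergents $p_k/q_k$ satisfy $q_0=1$, $q_1=1+d_1$, $q_{k}=d_kq_{k-1}+q_{k-2}$, and $|M_k|=q_k$. -}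

module Defs where

open import Data.Nat as ℕ using (ℕ; zero; suc; NonZero)
open import Data.Nat.Properties as ℕP using ()
open import Data.Integer as ℤ using (ℤ; +_)
open import Data.Rational as ℚ using (ℚ; _/_)
open import Data.List using (List; []; _∷_; _++_; concat; replicate)
open import Data.Product using (Σ; ∃; _×_; _,_)
open import Data.Sum using (_⊎_)
open import Relation.Nullary using (¬_; does)
open import Relation.Binary.PropositionalEquality using (_≡_)
open import Data.Bool using (if_then_else_)

-- Real numbers as (lower) Dedekind cuts of ℚ.
-- L q  means  q < x.

record ℝ : Set₁ where
  field
    L         : ℚ → Set
    inhabited : ∃ λ q → L q
    bounded   : ∃ λ q → ¬ L q
    downward  : ∀ p q → p ℚ.< q → L q → L p
    rounded   : ∀ q → L q → ∃ λ r → q ℚ.< r × L r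
    located   : ∀ p q → p ℚ.< q → L p ⊎ ¬ L q
open ℝ public

ℚ[_] : ℤ → ℚ
ℚ[ m ] = m / 1

ℚℕ : ℕ → ℚ
ℚℕ k = + k / 1

_<ℝ_ : ℚ → ℝ → Set
r <ℝ x = L x r

_ℝ<_ : ℝ → ℚ → Set
x ℝ< r = ∃ λ r' → r' ℚ.< r × ¬ L x r'

_≡ℚ_ : ℝ → ℚ → Set
x ≡ℚ r = (∀ r' → r' ℚ.< r → L x r') × (∀ r' → L x r' → r' ℚ.< r)

Irrational : ℝ → Set
Irrational x = ∀ r → ¬ (x ≡ℚ r)

-- Linear expressions  k·θ + ρ  (k : ℕ), described by their lower cut.

LowerLin : ℝ → ℝ → ℕ → ℚ → Set
LowerLin θ ρ k r = Σ ℚ λ s → Σ ℚ λ t → L θ s × L ρ t × r ℚ.< (ℚℕ k ℚ.* s ℚ.+ t)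

-- ⌊ k·θ + ρ ⌋ = m   i.e.  m ≤ kθ+ρ < m+1
FloorLinIs : ℝ → ℝ → ℕ → ℤ → Set
FloorLinIs θ ρ k m =
  (∀ r → r ℚ.< ℚ[ m ] → LowerLin θ ρ k r) ×
  (∃ λ r → r ℚ.< ℚ[ m ℤ.+ + 1 ] × ¬ LowerLin θ ρ k r)

-- ⌈ k·θ + ρ ⌉ = m   i.e.  m-1 < kθ+ρ ≤ m
CeilLinIs : ℝ → ℝ → ℕ → ℤ → Set
CeilLinIs θ ρ k m =
  LowerLin θ ρ k ℚ[ m ℤ.- + 1 ] ×
  (∀ r → LowerLin θ ρ k r → r ℚ.< ℚ[ m ])

letter : ℕ → ℕ → ℤ → ℤ → ℕ
letter a b m m' = if does (m ℤ.≟ m') then a else b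

-- Infinite words are functions ℕ → ℕ, indexed from 1 (value at 0 unused).

IsLowerMechanical : ℕ → ℕ → ℝ → ℝ → (ℕ → ℕ) → Set
IsLowerMechanical a b θ ρ s =
  ∀ n → 1 ℕ.≤ n → ∃ λ m → ∃ λ m' →
    FloorLinIs θ ρ n m × FloorLinIs θ ρ (n ℕ.∸ 1) m' × s n ≡ letter a b m m'

IsUpperMechanical : ℕ → ℕ → ℝ → ℝ → (ℕ → ℕ) → Set
IsUpperMechanical a b θ ρ s =
  ∀ n → 1 ℕ.≤ n → ∃ λ m → ∃ λ m' →
    CeilLinIs θ ρ n m × CeilLinIs θ ρ (n ℕ.∸ 1) m' × s n ≡ letter a b m m'

IsSturmian : ℕ → ℕ → ℝ → (ℕ → ℕ) → Set₁
IsSturmian a b θ s = Σ ℝ λ ρ →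
  (∀ r → r ℚ.< ℚ.0ℚ → L ρ r) × ρ ℝ< ℚ.1ℚ ×
  (IsLowerMechanical a b θ ρ s ⊎ IsUpperMechanical a b θ ρ s)

-- Continued fraction  θ = [0; 1+d₁, d₂, d₃, …]   (d 0 is unused)

qc : (ℕ → ℕ) → ℕ → ℕ
qc d zero = 1
qc d (suc zero) = 1 ℕ.+ d 1
qc d (suc (suc k)) = d (suc (suc k)) ℕ.* qc d (suc k) ℕ.+ qc d k

pc : (ℕ → ℕ) → ℕ → ℕ
pc d zero = 0
pc d (suc zero) = 1
pc d (suc (suc k)) = d (suc (suc k)) ℕ.* pc d (suc k) ℕ.+ pc d k

qc-pos : ∀ d k → 0 ℕ.< qc d k
qc-pos d zero = ℕ.s≤s ℕ.z≤n
qc-pos d (suc zero) = ℕ.s≤s ℕ.z≤n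
qc-pos d (suc (suc k)) =
  ℕP.<-≤-trans (qc-pos d k) (ℕP.m≤n+m (qc d k) (d (suc (suc k)) ℕ.* qc d (suc k)))

convergent : (ℕ → ℕ) → ℕ → ℚ
convergent d k = _/_ (+ pc d k) (qc d k) {{ℕ.>-nonZero (qc-pos d k)}}

IsCF : ℝ → (ℕ → ℕ) → Set
IsCF θ d = ∀ ε → ℚ.0ℚ ℚ.< ε → ∃ λ K → ∀ k → K ℕ.≤ k →
  (convergent d k ℚ.- ε) <ℝ θ × θ ℝ< (convergent d k ℚ.+ ε)

_^w_ : List ℕ → ℕ → List ℕ
M ^w j = concat (replicate j M)

-- Mw a b d k  =  M_{k-1}   (so Mw 0 = M_{-1} = b, Mw 1 = M_0 = a)
Mw : ℕ → ℕ → (ℕ → ℕ) → ℕ → List ℕ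
Mw a b d zero = b ∷ []
Mw a b d (suc zero) = a ∷ []
Mw a b d (suc (suc n)) = (Mw a b d (suc n) ^w d (suc n)) ++ Mw a b d n

-- window s i n = s_{i+1} s_{i+2} … s_{i+n}
window : (ℕ → ℕ) → ℕ → ℕ → List ℕ
window s i zero = []
window s i (suc n) = s (suc i) ∷ window s (suc i) n

FactorOfInf : List ℕ → (ℕ → ℕ) → Set
FactorOfInf M s = ∃ λ i → M ≡ window s i (Data.List.length M)

FactorOf : List ℕ → List ℕ → Set
FactorOf M W = ∃ λ x → ∃ λ y → W ≡ x ++ M ++ y

PrefixOf : List ℕ → List ℕ → Set
PrefixOf V W = ∃ λ y → W ≡ V ++ y

SuffixOf : List ℕ → List ℕ → Set
SuffixOf U W = ∃ λ x → W ≡ x ++ U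

module Submission where

-- Proof.  (1) Approximation: every window of a mechanical word of slope θ is a window
-- of a rotation t ↦ ⌊(c + t p_K)/q_K⌋ by a convergent of odd index K, with K as large
-- as we like (SlopeApproximation … SturmianWindows).  (2) Rotations: M_K is the jump
-- word of such a rotation over one period, so every window of length ≤ q_K of any
-- rotation by p_K/q_K is a factor of M_K M_K (FloorArithmetic, JumpWords,
-- StandardJumpWords).  (3) Combinatorics: for K > k, M_K M_K is a factor of a
-- concatenation of the blocks A = M_{k+1} and BA = M_k M_{k+1}, and every factor
-- shorter than A of such a block word satisfies the dichotomy (StandardWords.Blocks).

open import Defs
open import Data.Nat using (ℕ)
import Data.Nat as Nat

PositiveQuotients : (ℕ → ℕ) → Set
PositiveQuotients d = ∀ k → 1 Nat.≤ k → 1 Nat.≤ d k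

module WordFacts where

  open import Data.Nat using (ℕ; zero; suc; _≤_; _+_; _*_; s≤s)
  open import Data.List using (List; []; _∷_; length; _++_; reverse)
  open import Data.List.Properties
    using (++-assoc; length-++; ++-identityʳ; ∷-injective; reverse-++; length-reverse;
           reverse-selfInverse; reverse-involutive)
  open import Data.Product using (∃; _×_; _,_)
  open import Data.Sum using (_⊎_; inj₁; inj₂)
  open import Relation.Binary.PropositionalEquality
  open ≡-Reasoning

  ++-split : ∀ {A : Set} (u v x y : List A) → u ++ v ≡ x ++ y →
    (∃ λ e → x ≡ u ++ e × v ≡ e ++ y) ⊎ (∃ λ e → u ≡ x ++ e × y ≡ e ++ v)
  ++-split [] v x y eq = inj₁ (x , refl , eq)
  ++-split (c ∷ u) v [] y eq = inj₂ (c ∷ u , refl , sym eq)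
  ++-split (c ∷ u) v (c' ∷ x) y eq with ∷-injective eq
  ... | refl , eq' with ++-split u v x y eq'
  ...   | inj₁ (e , p , q) = inj₁ (e , cong (c ∷_) p , q)
  ...   | inj₂ (e , p , q) = inj₂ (e , cong (c ∷_) p , q)

  prefix-of-prefix : ∀ {A : Set} (V y X z : List A) → V ++ y ≡ X ++ z →
    length V ≤ length X → ∃ λ w → X ≡ V ++ w
  prefix-of-prefix [] y X z _ _ = X , refl
  prefix-of-prefix (c ∷ V) y (c' ∷ X) z eq (s≤s le) with ∷-injective eq
  ... | refl , eq' with prefix-of-prefix V y X z eq' le
  ...   | w , e = w , cong (c ∷_) e

  suffix-of-suffix : ∀ {A : Set} (x U z Y : List A) → x ++ U ≡ z ++ Y →
    length U ≤ length Y → ∃ λ w → Y ≡ w ++ U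
  suffix-of-suffix x U z Y eq le with prefix-of-prefix (reverse U) (reverse x) (reverse Y) (reverse z) eq′ le′
    where
    eq′ : reverse U ++ reverse x ≡ reverse Y ++ reverse z
    eq′ = trans (sym (reverse-++ x U)) (trans (cong reverse eq) (reverse-++ z Y))
    le′ : length (reverse U) ≤ length (reverse Y)
    le′ = subst₂ _≤_ (sym (length-reverse U)) (sym (length-reverse Y)) le
  ... | w , e = reverse w , (begin
    Y                              ≡⟨ sym (reverse-selfInverse e) ⟩
    reverse (reverse U ++ w)       ≡⟨ reverse-++ (reverse U) w ⟩
    reverse w ++ reverse (reverse U) ≡⟨ cong (reverse w ++_) (reverse-involutive U) ⟩
    reverse w ++ U                 ∎)

  ^w-comm : (X : List ℕ) (j : ℕ) → (X ^w j) ++ X ≡ X ++ (X ^w j)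
  ^w-comm X zero = sym (++-identityʳ X)
  ^w-comm X (suc j) = trans (++-assoc X (X ^w j) X) (cong (X ++_) (^w-comm X j))

  length-^w : (X : List ℕ) (j : ℕ) → length (X ^w j) ≡ j * length X
  length-^w X zero = refl
  length-^w X (suc j) = trans (length-++ X) (cong (length X +_) (length-^w X j))

  factor-trans : ∀ (u v W : List ℕ) → FactorOf u v → FactorOf v W → FactorOf u W
  factor-trans u v W (x′ , y′ , ev) (x , y , eW) = x ++ x′ , y′ ++ y , (begin
    W                          ≡⟨ eW ⟩
    x ++ v ++ y                ≡⟨ cong (λ t → x ++ t ++ y) ev ⟩
    x ++ (x′ ++ u ++ y′) ++ y  ≡⟨ cong (x ++_) (++-assoc x′ (u ++ y′) y) ⟩
    x ++ x′ ++ (u ++ y′) ++ y  ≡⟨ cong (λ t → x ++ x′ ++ t) (++-assoc u y′ y) ⟩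
    x ++ x′ ++ u ++ y′ ++ y    ≡⟨ sym (++-assoc x x′ _) ⟩
    (x ++ x′) ++ u ++ y′ ++ y  ∎)

  shared-prefix : ∀ {A : Set} (V y P r r′ : List A) → V ++ y ≡ P ++ r →
    length V ≤ length P → ∃ λ w → P ++ r′ ≡ V ++ w
  shared-prefix V y P r r′ eq le with prefix-of-prefix V y P r eq le
  ... | w , P≡ = w ++ r′ , trans (cong (_++ r′) P≡) (++-assoc V w r′)

module StandardWords (a b : ℕ) (d : ℕ → ℕ) where

  open WordFacts
  open import Data.Nat using (ℕ; zero; suc; _≤_; _<_; _+_; _*_; _∸_; z≤n; s≤s; _≤?_; pred; >-nonZero)
  open import Data.Nat.Properties
  open import Data.List using (List; []; _∷_; length; _++_)
  open import Data.List.Properties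
    using (++-assoc; length-++; ++-identityʳ; ++-conicalˡ; ++-conicalʳ; length-++-≤ˡ; length-++-≤ʳ)
  open import Data.Product using (∃; _×_; _,_; proj₁; proj₂)
  open import Data.Sum using (_⊎_; inj₁; inj₂)
  open import Relation.Nullary using (yes; no)
  open import Relation.Binary.PropositionalEquality
  open ≡-Reasoning

  -- M (suc k) is the paper's M_k; M 0 = M_{-1} = b.
  M : ℕ → List ℕ
  M = Mw a b d

  length-M : ∀ k → length (M (suc k)) ≡ qc d k
  length-M zero = refl
  length-M (suc zero) = begin
    length ((M 1 ^w d 1) ++ M 0)  ≡⟨ length-++ (M 1 ^w d 1) ⟩
    length (M 1 ^w d 1) + 1       ≡⟨ cong (_+ 1) (trans (length-^w (M 1) (d 1)) (*-identityʳ (d 1))) ⟩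
    d 1 + 1                       ≡⟨ +-comm (d 1) 1 ⟩
    1 + d 1                       ∎
  length-M (suc (suc k)) = begin
    length ((M (2 + k) ^w d (2 + k)) ++ M (suc k))  ≡⟨ length-++ (M (2 + k) ^w d (2 + k)) ⟩
    length (M (2 + k) ^w d (2 + k)) + length (M (suc k))
      ≡⟨ cong₂ _+_ (trans (length-^w (M (2 + k)) (d (2 + k))) (cong (d (2 + k) *_) (length-M (suc k)))) (length-M k) ⟩
    d (2 + k) * qc d (suc k) + qc d k  ∎

  length-M-pos : ∀ k → 1 ≤ length (M k)
  length-M-pos zero = s≤s z≤n
  length-M-pos (suc k) = subst (1 ≤_) (sym (length-M k)) (qc-pos d k)

  near-commutation : ∀ k → ∃ λ P → ∃ λ x → ∃ λ y →
    (M (suc k) ++ M k ≡ P ++ x ∷ y ∷ []) × (M k ++ M (suc k) ≡ P ++ y ∷ x ∷ [])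
  near-commutation zero = [] , a , b , refl , refl
  near-commutation (suc k) with near-commutation k
  ... | P , x , y , e₁ , e₂ = (X ^w j) ++ P , y , x , swapped₁ , swapped₂
    where
    X = M (suc k)
    j = d (suc k)
    swapped₁ : ((X ^w j) ++ M k) ++ X ≡ ((X ^w j) ++ P) ++ y ∷ x ∷ []
    swapped₁ = begin
      ((X ^w j) ++ M k) ++ X      ≡⟨ ++-assoc (X ^w j) (M k) X ⟩
      (X ^w j) ++ (M k ++ X)      ≡⟨ cong ((X ^w j) ++_) e₂ ⟩
      (X ^w j) ++ P ++ y ∷ x ∷ [] ≡⟨ sym (++-assoc (X ^w j) P _) ⟩
      ((X ^w j) ++ P) ++ y ∷ x ∷ [] ∎
    swapped₂ : X ++ ((X ^w j) ++ M k) ≡ ((X ^w j) ++ P) ++ x ∷ y ∷ []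
    swapped₂ = begin
      X ++ ((X ^w j) ++ M k)      ≡⟨ sym (++-assoc X (X ^w j) (M k)) ⟩
      (X ++ (X ^w j)) ++ M k      ≡⟨ cong (_++ M k) (sym (^w-comm X j)) ⟩
      ((X ^w j) ++ X) ++ M k      ≡⟨ ++-assoc (X ^w j) X (M k) ⟩
      (X ^w j) ++ (X ++ M k)      ≡⟨ cong ((X ^w j) ++_) e₁ ⟩
      (X ^w j) ++ P ++ x ∷ y ∷ [] ≡⟨ sym (++-assoc (X ^w j) P _) ⟩
      ((X ^w j) ++ P) ++ x ∷ y ∷ [] ∎

  -- Level k of the block decomposition (paper indexing: A = M_{k+1}, B = M_k,
  -- C = M_{k-1}, so that A = B^{d_{k+1}} C).
  module Blocks (k : ℕ) (d≥1 : 1 ≤ d (suc k)) where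

    A B C : List ℕ
    A = M (suc (suc k))
    B = M (suc k)
    C = M k

    data Block : List ℕ → Set where
      A-block  : Block A
      BA-block : Block (B ++ A)

    data BlockWord : List ℕ → Set where
      []ᵇ  : BlockWord []
      _∷ᵇ_ : ∀ {S W} → Block S → BlockWord W → BlockWord (S ++ W)

    Dichotomy : List ℕ → Set
    Dichotomy w = (∃ λ j → 1 ≤ j × FactorOf w ((B ^w j) ++ C))
      ⊎ (∃ λ U → ∃ λ V → w ≡ U ++ V × SuffixOf U A × PrefixOf V A × qc d k ∸ 1 ≤ length V)

    block-power : ∀ {S} → Block S → ∃ λ j → 1 ≤ j × S ≡ (B ^w j) ++ C
    block-power A-block = d (suc k) , d≥1 , refl
    block-power BA-block = suc (d (suc k)) , s≤s z≤n , sym (++-assoc B (B ^w d (suc k)) C)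

    block-starts-B : ∀ {S} → Block S → ∃ λ r → S ≡ B ++ r
    block-starts-B A-block = (B ^w pred (d (suc k))) ++ C , (begin
      (B ^w d (suc k)) ++ C                   ≡⟨ cong (λ j → (B ^w j) ++ C) (sym (suc-pred (d (suc k)) {{>-nonZero d≥1}})) ⟩
      (B ++ (B ^w pred (d (suc k)))) ++ C     ≡⟨ ++-assoc B _ C ⟩
      B ++ (B ^w pred (d (suc k))) ++ C       ∎)
    block-starts-B BA-block = A , refl

    -- Every block ends with A, so its short suffixes are suffixes of A.
    block-suffix : ∀ {S} → Block S → ∀ x U → S ≡ x ++ U → length U ≤ length A → SuffixOf U A
    block-suffix A-block x U eq _ = x , eq
    block-suffix BA-block x U eq le = suffix-of-suffix x U B A (sym eq) le

    -- A prefix shorter than A of a block followed by anything is a prefix of A.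
    -- For the block BA this uses that BA and AB agree up to their last two letters.
    block-prefix : ∀ {S} → Block S → ∀ W V y → S ++ W ≡ V ++ y → length V < length A → PrefixOf V A
    block-prefix A-block W V y eq lt = prefix-of-prefix V y A W (sym eq) (<⇒≤ lt)
    block-prefix BA-block W V y eq lt with near-commutation (suc k)
    ... | P , x , z , AB≡ , BA≡ with shared-prefix V y P (z ∷ x ∷ W) (x ∷ z ∷ []) V++y≡ |V|≤|P|
      where
      V++y≡ : V ++ y ≡ P ++ z ∷ x ∷ W
      V++y≡ = trans (sym eq) (trans (cong (_++ W) BA≡) (++-assoc P (z ∷ x ∷ []) W))
      |V|≤|P| : length V ≤ length P
      |V|≤|P| = +-cancelˡ-≤ 2 _ _ (≤-Reasoning.begin
        2 + length V                  ≤-Reasoning.≤⟨ +-mono-≤ (length-M-pos (suc k)) lt ⟩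
        length B + length A           ≤-Reasoning.≡⟨ sym (length-++ B) ⟩
        length (B ++ A)               ≤-Reasoning.≡⟨ cong length BA≡ ⟩
        length (P ++ z ∷ x ∷ [])      ≤-Reasoning.≡⟨ length-++ P ⟩
        length P + 2                  ≤-Reasoning.≡⟨ +-comm (length P) 2 ⟩
        2 + length P                  ≤-Reasoning.∎)
    ... | w , P++xz≡ = prefix-of-prefix V w A B (sym (trans AB≡ P++xz≡)) (<⇒≤ lt)

    short-prefix-commutes : ∀ V z → B ≡ V ++ z → 2 + length V ≤ length B →
      ∃ λ z′ → B ++ C ≡ C ++ V ++ z′
    short-prefix-commutes V z B≡ short with near-commutation k
    ... | P , x , y , BC≡ , CB≡ with shared-prefix (C ++ V) z P (y ∷ x ∷ []) (x ∷ y ∷ []) CVz≡ |CV|≤|P|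
      where
      CVz≡ : (C ++ V) ++ z ≡ P ++ y ∷ x ∷ []
      CVz≡ = trans (++-assoc C V z) (trans (cong (C ++_) (sym B≡)) CB≡)
      |CV|≤|P| : length (C ++ V) ≤ length P
      |CV|≤|P| = +-cancelˡ-≤ 2 _ _ (≤-Reasoning.begin
        2 + length (C ++ V)           ≤-Reasoning.≡⟨ cong (2 +_) (trans (length-++ C) (+-comm (length C) _)) ⟩
        2 + length V + length C       ≤-Reasoning.≤⟨ +-monoˡ-≤ (length C) short ⟩
        length B + length C           ≤-Reasoning.≡⟨ sym (length-++ B) ⟩
        length (B ++ C)               ≤-Reasoning.≡⟨ cong length BC≡ ⟩
        length (P ++ x ∷ y ∷ [])      ≤-Reasoning.≡⟨ length-++ P ⟩
        length P + 2                  ≤-Reasoning.≡⟨ +-comm (length P) 2 ⟩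
        2 + length P                  ≤-Reasoning.∎)
    ... | w , P++xy≡ = w , trans BC≡ (trans P++xy≡ (++-assoc C V w))

    prefix-A : ∀ {W} → BlockWord W → ∀ V y → W ≡ V ++ y → length V < length A → PrefixOf V A
    prefix-A []ᵇ V y eq _ = A , cong (_++ A) (sym (++-conicalˡ V y (sym eq)))
    prefix-A (_∷ᵇ_ {W = W} blk _) V y eq lt = block-prefix blk W V y eq lt

    prefix-B : ∀ {W} → BlockWord W → ∀ V y → W ≡ V ++ y → length V ≤ length B → PrefixOf V B
    prefix-B []ᵇ V y eq _ = B , cong (_++ B) (sym (++-conicalˡ V y (sym eq)))
    prefix-B (_∷ᵇ_ {W = W} blk _) V y eq le with block-starts-B blk
    ... | r , S≡ = prefix-of-prefix V y B (r ++ W) (trans (sym eq) (trans (cong (_++ W) S≡) (++-assoc B r W))) le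

    -- A word U₀V straddling a block boundary, with V short, lies in some B^j C:
    -- U₀ is a suffix of B^j C and C V is a prefix of B C.
    straddling-short : ∀ {S W} → Block S → BlockWord W → ∀ x U₀ V y → S ≡ x ++ U₀ → W ≡ V ++ y →
      2 + length V ≤ length B → ∃ λ j → 1 ≤ j × FactorOf (U₀ ++ V) ((B ^w j) ++ C)
    straddling-short blk blks x U₀ V y S≡ W≡ short
      with prefix-B blks V y W≡ (≤-trans (m≤n+m (length V) 2) short) | block-power blk
    ... | z , B≡ | j , _ , S≡Bʲ with short-prefix-commutes V z B≡ short | ++-split x U₀ (B ^w j) C (trans (sym S≡) S≡Bʲ)
    ... | z′ , BC≡ | inj₁ (e , Bʲ≡ , U₀≡) = suc j , s≤s z≤n , x , z′ , (begin
      (B ++ (B ^w j)) ++ C             ≡⟨ cong (_++ C) (sym (^w-comm B j)) ⟩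
      ((B ^w j) ++ B) ++ C             ≡⟨ ++-assoc (B ^w j) B C ⟩
      (B ^w j) ++ (B ++ C)             ≡⟨ cong₂ _++_ Bʲ≡ BC≡ ⟩
      (x ++ e) ++ (C ++ V ++ z′)       ≡⟨ ++-assoc x e _ ⟩
      x ++ (e ++ C ++ V ++ z′)         ≡⟨ cong (x ++_) (sym (++-assoc e C _)) ⟩
      x ++ ((e ++ C) ++ V ++ z′)       ≡⟨ cong (x ++_) (sym (++-assoc (e ++ C) V z′)) ⟩
      x ++ ((e ++ C) ++ V) ++ z′       ≡⟨ cong (λ u → x ++ (u ++ V) ++ z′) (sym U₀≡) ⟩
      x ++ (U₀ ++ V) ++ z′             ∎)
    ... | z′ , BC≡ | inj₂ (e , _ , C≡) = 1 , s≤s z≤n , e , z′ , (begin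
      (B ++ []) ++ C                   ≡⟨ cong (_++ C) (++-identityʳ B) ⟩
      B ++ C                           ≡⟨ BC≡ ⟩
      C ++ V ++ z′                     ≡⟨ cong (_++ V ++ z′) C≡ ⟩
      (e ++ U₀) ++ V ++ z′             ≡⟨ ++-assoc e U₀ _ ⟩
      e ++ U₀ ++ V ++ z′               ≡⟨ cong (e ++_) (sym (++-assoc U₀ V z′)) ⟩
      e ++ (U₀ ++ V) ++ z′             ∎)

    straddling : ∀ {S W} → Block S → BlockWord W → ∀ x U₀ V y → S ≡ x ++ U₀ → W ≡ V ++ y →
      length (U₀ ++ V) < length A → Dichotomy (U₀ ++ V)
    straddling blk blks x U₀ V y S≡ W≡ lt with qc d k ∸ 1 ≤? length V
    ... | yes long = inj₂ (U₀ , V , refl , block-suffix blk x U₀ S≡ (≤-trans (length-++-≤ˡ U₀) (<⇒≤ lt))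
                          , prefix-A blks V y W≡ (≤-<-trans (length-++-≤ʳ V {U₀}) lt) , long)
    ... | no ¬long = inj₁ (straddling-short blk blks x U₀ V y S≡ W≡ short)
      where
      short : 2 + length V ≤ length B
      short = subst (2 + length V ≤_) (trans (m+[n∸m]≡n (qc-pos d k)) (sym (length-M k))) (s≤s (≰⇒> ¬long))

    factor-of-blocks : ∀ {W} → BlockWord W → ∀ x w y → W ≡ x ++ w ++ y → length w < length A → Dichotomy w
    factor-of-blocks []ᵇ x w y eq _ = inj₁ (1 , s≤s z≤n , [] , (B ^w 1) ++ C , cong (_++ (B ^w 1) ++ C) (sym w≡[]))
      where
      w≡[] : w ≡ []
      w≡[] = ++-conicalˡ w y (++-conicalʳ x (w ++ y) (sym eq))
    factor-of-blocks (_∷ᵇ_ {S} {W} blk blks) x w y eq lt with ++-split x (w ++ y) S W (sym eq)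
    ... | inj₂ (e , _ , W≡) = factor-of-blocks blks e w y W≡ lt
    ... | inj₁ (U₀ , S≡ , wy≡) with ++-split w y U₀ W wy≡
    ...   | inj₁ (e , U₀≡ , _) with block-power blk
    ...     | j , j≥1 , S≡Bʲ = inj₁ (j , j≥1 , x , e , trans (sym S≡Bʲ) (trans S≡ (cong (x ++_) U₀≡)))
    factor-of-blocks (_∷ᵇ_ {S} {W} blk blks) x w y eq lt
        | inj₁ (U₀ , S≡ , wy≡) | inj₂ (V , w≡ , W≡) =
      subst Dichotomy (sym w≡) (straddling blk blks x U₀ V y S≡ W≡ (subst (λ u → length u < length A) w≡ lt))

    blocks-++ : ∀ {u v} → BlockWord u → BlockWord v → BlockWord (u ++ v)
    blocks-++ []ᵇ bv = bv
    blocks-++ {v = v} (_∷ᵇ_ {S} {W} blk bu) bv = subst BlockWord (sym (++-assoc S W v)) (blk ∷ᵇ blocks-++ bu bv)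

    blocks-BA : ∀ {u} → BlockWord u → BlockWord (B ++ A ++ u)
    blocks-BA {u} bu = subst BlockWord (++-assoc B A u) (BA-block ∷ᵇ bu)

    blocks-Aʲ : ∀ j → BlockWord (A ^w j)
    blocks-Aʲ zero = []ᵇ
    blocks-Aʲ (suc j) = A-block ∷ᵇ blocks-Aʲ j

    -- The two shapes of the standard words M_N, N ≥ k+1 (paper indexing):
    -- A·(block word) and A·(block word)·B.
    ShapeA ShapeAB : List ℕ → Set
    ShapeA X = ∃ λ u → BlockWord u × X ≡ A ++ u
    ShapeAB X = ∃ λ u → BlockWord u × X ≡ A ++ u ++ B

    -- (A u B)^j (A v) has shape A·(block word), since B A is a block.
    power-ShapeA : ∀ {u v} → BlockWord u → BlockWord v → ∀ j → ShapeA (((A ++ u ++ B) ^w j) ++ (A ++ v))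
    power-ShapeA {v = v} _ bv zero = v , bv , refl
    power-ShapeA {u} {v} bu bv (suc j) with power-ShapeA bu bv j
    ... | w , bw , eq = u ++ B ++ A ++ w , blocks-++ bu (blocks-BA bw) , (begin
      (X ++ (X ^w j)) ++ (A ++ v)    ≡⟨ ++-assoc X (X ^w j) _ ⟩
      X ++ ((X ^w j) ++ (A ++ v))    ≡⟨ cong (X ++_) eq ⟩
      (A ++ u ++ B) ++ A ++ w        ≡⟨ ++-assoc A (u ++ B) _ ⟩
      A ++ (u ++ B) ++ A ++ w        ≡⟨ cong (A ++_) (++-assoc u B _) ⟩
      A ++ u ++ B ++ A ++ w          ∎)
      where
      X = A ++ u ++ B

    power-ShapeAB : ∀ {u v} → BlockWord u → BlockWord v → ∀ j → ShapeAB (((A ++ u) ^w j) ++ (A ++ v ++ B))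
    power-ShapeAB {v = v} _ bv zero = v , bv , refl
    power-ShapeAB {u} {v} bu bv (suc j) with power-ShapeAB bu bv j
    ... | w , bw , eq = u ++ A ++ w , blocks-++ bu (A-block ∷ᵇ bw) , (begin
      (Y ++ (Y ^w j)) ++ (A ++ v ++ B)  ≡⟨ ++-assoc Y (Y ^w j) _ ⟩
      Y ++ ((Y ^w j) ++ (A ++ v ++ B))  ≡⟨ cong (Y ++_) eq ⟩
      (A ++ u) ++ A ++ w ++ B           ≡⟨ ++-assoc A u _ ⟩
      A ++ u ++ A ++ w ++ B             ≡⟨ cong (λ t → A ++ u ++ t) (sym (++-assoc A w B)) ⟩
      A ++ u ++ (A ++ w) ++ B           ≡⟨ cong (A ++_) (sym (++-assoc u (A ++ w) B)) ⟩
      A ++ (u ++ A ++ w) ++ B           ∎)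
      where
      Y = A ++ u

    -- Consecutive standard words from M_{k+1} on alternate between the two shapes
    -- (M_{N+1} = M_N^{d} M_{N-1}); this needs d_{k+2} ≥ 1 to start.
    Shapes : ℕ → Set
    Shapes N = (ShapeA (M N) × ShapeAB (M (suc N))) ⊎ (ShapeAB (M N) × ShapeA (M (suc N)))

    alternating-shapes : 1 ≤ d (suc (suc k)) → ∀ m → Shapes (m + suc (suc k))
    alternating-shapes d′≥1 zero = inj₁ (([] , []ᵇ , sym (++-identityʳ A)) , (A ^w j , blocks-Aʲ j , (begin
      (A ^w d (suc (suc k))) ++ B  ≡⟨ cong (λ t → (A ^w t) ++ B) (sym (suc-pred (d (suc (suc k))) {{>-nonZero d′≥1}})) ⟩
      (A ++ (A ^w j)) ++ B         ≡⟨ ++-assoc A (A ^w j) B ⟩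
      A ++ (A ^w j) ++ B           ∎)))
      where
      j = pred (d (suc (suc k)))
    alternating-shapes d′≥1 (suc m) with alternating-shapes d′≥1 m
    ... | inj₁ ((v , bv , eqv) , (u , bu , equ)) with power-ShapeA bu bv (d (suc (m + suc (suc k))))
    ...   | w , bw , eq = inj₂ ((u , bu , equ) , (w , bw , trans (cong₂ (λ s t → (s ^w d (suc (m + suc (suc k)))) ++ t) equ eqv) eq))
    alternating-shapes d′≥1 (suc m)
        | inj₂ ((v , bv , eqv) , (u , bu , equ)) with power-ShapeAB bu bv (d (suc (m + suc (suc k))))
    ...   | w , bw , eq = inj₁ ((u , bu , equ) , (w , bw , trans (cong₂ (λ s t → (s ^w d (suc (m + suc (suc k)))) ++ t) equ eqv) eq))

    square-in-blocks : ∀ {X} → ShapeA X ⊎ ShapeAB X → ∃ λ W → BlockWord W × FactorOf (X ++ X) W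
    square-in-blocks {X} (inj₁ (u , bu , eq)) =
      (A ++ u) ++ (A ++ u) , subst BlockWord (sym (++-assoc A u (A ++ u))) (A-block ∷ᵇ blocks-++ bu (A-block ∷ᵇ bu)) ,
      [] , [] , trans (cong₂ _++_ (sym eq) (sym eq)) (sym (++-identityʳ (X ++ X)))
    square-in-blocks {X} (inj₂ (u , bu , eq)) =
      A ++ u ++ B ++ A ++ u ++ B ++ A ,
      A-block ∷ᵇ blocks-++ bu (blocks-BA (blocks-++ bu (subst BlockWord (++-identityʳ (B ++ A)) (BA-block ∷ᵇ []ᵇ)))) ,
      [] , A , (begin
        A ++ u ++ B ++ A ++ u ++ B ++ A        ≡⟨ cong (λ t → A ++ u ++ B ++ t) (sym (assoc₃ A u B A)) ⟩
        A ++ u ++ B ++ ((A ++ u ++ B) ++ A)    ≡⟨ sym (assoc₃ A u B _) ⟩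
        (A ++ u ++ B) ++ ((A ++ u ++ B) ++ A)  ≡⟨ cong₂ (λ s t → s ++ t ++ A) (sym eq) (sym eq) ⟩
        X ++ X ++ A                            ≡⟨ sym (++-assoc X X A) ⟩
        (X ++ X) ++ A                          ∎)
      where
      assoc₃ : ∀ (P Q R T : List ℕ) → (P ++ Q ++ R) ++ T ≡ P ++ Q ++ R ++ T
      assoc₃ P Q R T = trans (++-assoc P (Q ++ R) T) (cong (P ++_) (++-assoc Q R T))

    standard-square-in-blocks : 1 ≤ d (suc (suc k)) → ∀ N → suc (suc k) ≤ N →
      ∃ λ W → BlockWord W × FactorOf (M N ++ M N) W
    standard-square-in-blocks d′≥1 N le = subst (λ N → ∃ λ W → BlockWord W × FactorOf (M N ++ M N) W)
      (m∸n+n≡m le) (square-in-blocks (first-shape {N ∸ suc (suc k) + suc (suc k)} (alternating-shapes d′≥1 (N ∸ suc (suc k)))))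
      where
      first-shape : ∀ {N} → Shapes N → ShapeA (M N) ⊎ ShapeAB (M N)
      first-shape (inj₁ (sh , _)) = inj₁ sh
      first-shape (inj₂ (sh , _)) = inj₂ sh

module FloorArithmetic where

  open import Data.Nat
  open import Data.Nat.Properties
  open import Data.Nat.DivMod
  open import Data.Nat.Divisibility using (_∣_; ∣m+n∣m⇒∣n; ∣⇒≤; n∣m*n; divides)
  open import Relation.Binary.PropositionalEquality
  open import Data.Product using (∃; _×_; _,_; proj₁; proj₂)
  open import Data.Sum using (_⊎_; inj₁; inj₂)
  open import Data.Nat.Solver using (module +-*-Solver)
  open +-*-Solver
  open ≤-Reasoning

  floor-lower : ∀ N D .{{_ : NonZero D}} → D * (N / D) ≤ N
  floor-lower N D = subst (_≤ N) (*-comm (N / D) D) (m/n*n≤m N D)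

  floor-upper : ∀ N D .{{_ : NonZero D}} → N < D * suc (N / D)
  floor-upper N D = begin-strict
    N ≡⟨ m≡m%n+[m/n]*n N D ⟩
    N % D + (N / D) * D <⟨ +-monoˡ-< ((N / D) * D) (m%n<n N D) ⟩
    D + (N / D) * D ≡⟨ trans (cong (D +_) (*-comm (N / D) D)) (sym (*-suc D (N / D))) ⟩
    D * suc (N / D) ∎

  floor-unique : ∀ N D x .{{_ : NonZero D}} → D * x ≤ N → N < D * suc x → N / D ≡ x
  floor-unique N D x lo hi = ≤-antisym (≤-pred (*-cancelˡ-< D (N / D) (suc x) (≤-<-trans (floor-lower N D) hi)))
                                  (≤-pred (*-cancelˡ-< D x (suc (N / D)) (≤-<-trans lo (floor-upper N D))))

  /-+-multiple : ∀ m Z q .{{_ : NonZero q}} → (m + Z * q) / q ≡ m / q + Z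
  /-+-multiple m Z q = trans (+-distrib-/-∣ʳ m (n∣m*n Z)) (cong (λ z → m / q + z) (m*n/n≡m Z q))

  -- If pQ − Pq = 1 and 1 ≤ u ≤ Q, then ⌊(up − 1)/q⌋ = x implies ⌊uP/Q⌋ = x
  -- (stated through the defining inequalities of the two floors).
  head-bounds-odd : ∀ p q P Q u x .{{_ : NonZero q}} → p * Q ≡ P * q + 1 → 1 ≤ u → u ≤ Q →
    q * x + 1 ≤ u * p → u * p ≤ q * x + q → Q * x ≤ u * P × u * P < Q * suc x
  head-bounds-odd p q P Q u x H hu1 huQ h1 h2 = lower , upper
    where
    key : q * (u * P) + u ≡ Q * (u * p)
    key = trans (solve 4 (λ q u P Q → q :* (u :* P) :+ u := u :* (P :* q :+ con 1)) refl q u P Q)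
          (trans (cong (u *_) (sym H)) (solve 4 (λ u p Q q → u :* (p :* Q) := Q :* (u :* p)) refl u p Q q))
    lower : Q * x ≤ u * P
    lower = *-cancelˡ-≤ q (+-cancelʳ-≤ Q _ _ (begin
      q * (Q * x) + Q ≡⟨ solve 3 (λ q Q x → q :* (Q :* x) :+ Q := Q :* (q :* x :+ con 1)) refl q Q x ⟩
      Q * (q * x + 1) ≤⟨ *-monoʳ-≤ Q h1 ⟩
      Q * (u * p) ≡⟨ sym key ⟩
      q * (u * P) + u ≤⟨ +-monoʳ-≤ (q * (u * P)) huQ ⟩
      q * (u * P) + Q ∎))
    upper : u * P < Q * suc x
    upper = *-cancelˡ-< q _ _ (begin-strict
      q * (u * P) <⟨ m<m+n (q * (u * P)) hu1 ⟩
      q * (u * P) + u ≡⟨ key ⟩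
      Q * (u * p) ≤⟨ *-monoʳ-≤ Q h2 ⟩
      Q * (q * x + q) ≡⟨ solve 3 (λ q Q x → Q :* (q :* x :+ q) := q :* (Q :* (con 1 :+ x))) refl q Q x ⟩
      q * (Q * suc x) ∎)

  -- If Pq − pQ = 1 and 1 ≤ u ≤ Q, then ⌊up/q⌋ = x implies ⌊(uP − 1)/Q⌋ = x.
  head-bounds-even : ∀ p q P Q u x .{{_ : NonZero q}} → P * q ≡ p * Q + 1 → 1 ≤ u → u ≤ Q →
    q * x ≤ u * p → u * p + 1 ≤ q * suc x → Q * x + 1 ≤ u * P × u * P ≤ Q * suc x
  head-bounds-even p q P Q u x H hu1 huQ h1 h2 = lower , upper
    where
    key : q * (u * P) ≡ Q * (u * p) + u
    key = trans (solve 4 (λ q u P Q → q :* (u :* P) := u :* (P :* q)) refl q u P Q)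
          (trans (cong (u *_) H) (solve 4 (λ u p Q q → u :* (p :* Q :+ con 1) := Q :* (u :* p) :+ u) refl u p Q q))
    lower : Q * x + 1 ≤ u * P
    lower = subst (_≤ u * P) (+-comm 1 (Q * x)) (*-cancelˡ-< q _ _ (begin-strict
      q * (Q * x) ≡⟨ solve 3 (λ q Q x → q :* (Q :* x) := Q :* (q :* x)) refl q Q x ⟩
      Q * (q * x) ≤⟨ *-monoʳ-≤ Q h1 ⟩
      Q * (u * p) <⟨ m<m+n (Q * (u * p)) hu1 ⟩
      Q * (u * p) + u ≡⟨ sym key ⟩
      q * (u * P) ∎))
    upper : u * P ≤ Q * suc x
    upper = *-cancelˡ-≤ q (begin
      q * (u * P) ≡⟨ key ⟩
      Q * (u * p) + u ≤⟨ +-monoʳ-≤ (Q * (u * p)) huQ ⟩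
      Q * (u * p) + Q ≡⟨ solve 3 (λ Q u p → Q :* (u :* p) :+ Q := Q :* (u :* p :+ con 1)) refl Q (u) p ⟩
      Q * (u * p + 1) ≤⟨ *-monoʳ-≤ Q h2 ⟩
      Q * (q * suc x) ≡⟨ solve 3 (λ Q q x → Q :* (q :* x) := q :* (Q :* x)) refl Q q (suc x) ⟩
      q * (Q * suc x) ∎)

  divisor-≤ : ∀ {q' u p'} → 1 ≤ u → (q' ∣ u * p' → q' ∣ u) → ∀ z → u * p' ≡ q' * z → q' ≤ u
  divisor-≤ {q'} {u} {p'} hu cop z eq = ∣⇒≤ {{>-nonZero hu}} (cop (divides z (trans eq (*-comm q' z))))

  -- If Pq′ − p′Q = d, 1 ≤ u ≤ q′ + 1, q′ is coprime to p′ (relative to u) and Q is large,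
  -- then ⌊up′/q′⌋ = y implies ⌊(uP − d)/Q⌋ = y (in inequality form).
  tail-bounds-odd : ∀ p' q' P Q u y d .{{_ : NonZero q'}} → P * q' ≡ p' * Q + d → 1 ≤ u → u ≤ suc q' →
    d * q' ≤ Q → d + q' ≤ Q → (q' ∣ u * p' → q' ∣ u) →
    q' * y ≤ u * p' → u * p' + 1 ≤ q' * suc y → Q * y + d ≤ u * P × u * P + 1 ≤ Q * y + Q + d
  tail-bounds-odd p' q' P Q u y d H hu1 hu2 dq′≤Q d+q′≤Q cop h1 h2 = lower , upper
    where
    key : q' * (u * P) ≡ Q * (u * p') + u * d
    key = trans (solve 4 (λ q' u P Q → q' :* (u :* P) := u :* (P :* q')) refl q' u P Q)
          (trans (cong (u *_) H) (solve 4 (λ u p' Q d → u :* (p' :* Q :+ d) := Q :* (u :* p') :+ u :* d) refl u p' Q d))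
    e1 : q' * (Q * y + d) ≡ Q * (q' * y) + q' * d
    e1 = solve 4 (λ q' Q y d → q' :* (Q :* y :+ d) := Q :* (q' :* y) :+ q' :* d) refl q' Q y d
    lower : Q * y + d ≤ u * P
    lower with m≤n⇒m<n∨m≡n h1
    ... | inj₂ eq = *-cancelˡ-≤ q' (begin
          q' * (Q * y + d) ≡⟨ e1 ⟩
          Q * (q' * y) + q' * d ≡⟨ cong (λ t → Q * t + q' * d) eq ⟩
          Q * (u * p') + q' * d ≤⟨ +-monoʳ-≤ (Q * (u * p')) (*-monoˡ-≤ d (divisor-≤ hu1 cop y (sym eq))) ⟩
          Q * (u * p') + u * d ≡⟨ sym key ⟩
          q' * (u * P) ∎)
    ... | inj₁ lt = *-cancelˡ-≤ q' (begin
          q' * (Q * y + d) ≡⟨ e1 ⟩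
          Q * (q' * y) + q' * d ≤⟨ +-monoʳ-≤ (Q * (q' * y)) (subst (_≤ Q) (*-comm d q') dq′≤Q) ⟩
          Q * (q' * y) + Q ≡⟨ solve 2 (λ Q n → Q :* n :+ Q := Q :* (con 1 :+ n)) refl Q (q' * y) ⟩
          Q * suc (q' * y) ≤⟨ *-monoʳ-≤ Q lt ⟩
          Q * (u * p') ≤⟨ m≤m+n _ _ ⟩
          Q * (u * p') + u * d ≡⟨ sym key ⟩
          q' * (u * P) ∎)
    h2' : Q * (u * p') + Q ≤ Q * (q' * suc y)
    h2' = subst (_≤ Q * (q' * suc y)) (solve 2 (λ Q n → Q :* (n :+ con 1) := Q :* n :+ Q) refl Q (u * p')) (*-monoʳ-≤ Q h2)
    hh : u * d + q' ≤ q' * d + Q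
    hh = begin
      u * d + q' ≤⟨ +-monoˡ-≤ q' (*-monoˡ-≤ d hu2) ⟩
      suc q' * d + q' ≡⟨ solve 2 (λ q' d → (con 1 :+ q') :* d :+ q' := q' :* d :+ (d :+ q')) refl q' d ⟩
      q' * d + (d + q') ≤⟨ +-monoʳ-≤ (q' * d) d+q′≤Q ⟩
      q' * d + Q ∎
    upper : u * P + 1 ≤ Q * y + Q + d
    upper = *-cancelˡ-≤ q' (+-cancelʳ-≤ Q _ _ (begin
      q' * (u * P + 1) + Q ≡⟨ solve 4 (λ q' u P Q → q' :* (u :* P :+ con 1) :+ Q := q' :* (u :* P) :+ q' :+ Q) refl q' u P Q ⟩
      q' * (u * P) + q' + Q ≡⟨ cong (λ t → t + q' + Q) key ⟩
      Q * (u * p') + u * d + q' + Q ≡⟨ solve 5 (λ A B q' Q x → A :+ B :+ q' :+ Q := (A :+ Q) :+ (B :+ q')) refl (Q * (u * p')) (u * d) q' Q 0 ⟩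
      (Q * (u * p') + Q) + (u * d + q') ≤⟨ +-mono-≤ h2' hh ⟩
      Q * (q' * suc y) + (q' * d + Q) ≡⟨ solve 5 (λ Q q' y d x → Q :* (q' :* (con 1 :+ y)) :+ (q' :* d :+ Q) := q' :* (Q :* y :+ Q :+ d) :+ Q) refl Q q' y d 0 ⟩
      q' * (Q * y + Q + d) + Q ∎))

  -- If p′Q − Pq′ = d under the same side conditions, then ⌊(up′ − 1)/q′⌋ = y
  -- implies ⌊(uP + d − 1)/Q⌋ = y.
  tail-bounds-even : ∀ p' q' P Q u y d .{{_ : NonZero q'}} → p' * Q ≡ P * q' + d → 1 ≤ u → u ≤ suc q' →
    d * q' ≤ Q → d + q' ≤ Q → (q' ∣ u * p' → q' ∣ u) →
    q' * y + 1 ≤ u * p' → u * p' ≤ q' * suc y → Q * y + 1 ≤ d + u * P × d + u * P ≤ Q * suc y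
  tail-bounds-even p' q' P Q u y d H hu1 hu2 dq′≤Q d+q′≤Q cop h1 h2 = lower , upper
    where
    key : q' * (u * P) + u * d ≡ Q * (u * p')
    key = trans (solve 5 (λ q' u P Q d → q' :* (u :* P) :+ u :* d := u :* (P :* q' :+ d)) refl q' u P Q d)
          (trans (cong (u *_) (sym H)) (solve 3 (λ u p' Q → u :* (p' :* Q) := Q :* (u :* p')) refl u p' Q))
    h1' : Q * (q' * y) + Q ≤ Q * (u * p')
    h1' = subst (_≤ Q * (u * p')) (solve 3 (λ Q q' y → Q :* (q' :* y :+ con 1) := Q :* (q' :* y) :+ Q) refl Q q' y) (*-monoʳ-≤ Q h1)
    hh : q' + u * d ≤ Q + q' * d
    hh = begin
      q' + u * d ≤⟨ +-monoʳ-≤ q' (*-monoˡ-≤ d hu2) ⟩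
      q' + suc q' * d ≡⟨ solve 2 (λ q' d → q' :+ (con 1 :+ q') :* d := (d :+ q') :+ q' :* d) refl q' d ⟩
      (d + q') + q' * d ≤⟨ +-monoˡ-≤ (q' * d) d+q′≤Q ⟩
      Q + q' * d ∎
    lower : Q * y + 1 ≤ d + u * P
    lower = *-cancelˡ-≤ q' (+-cancelʳ-≤ (u * d) _ _ (+-cancelʳ-≤ Q _ _ (begin
      q' * (Q * y + 1) + u * d + Q ≡⟨ solve 6 (λ q' Q y ud x z → q' :* (Q :* y :+ con 1) :+ ud :+ Q := (Q :* (q' :* y) :+ Q) :+ (q' :+ ud)) refl q' Q y (u * d) 0 0 ⟩
      (Q * (q' * y) + Q) + (q' + u * d) ≤⟨ +-mono-≤ h1' hh ⟩
      Q * (u * p') + (Q + q' * d) ≡⟨ cong (_+ (Q + q' * d)) (sym key) ⟩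
      q' * (u * P) + u * d + (Q + q' * d) ≡⟨ solve 6 (λ q' uP ud Q d x → q' :* uP :+ ud :+ (Q :+ q' :* d) := q' :* (d :+ uP) :+ ud :+ Q) refl q' (u * P) (u * d) Q d 0 ⟩
      q' * (d + u * P) + u * d + Q ∎)))
    upper : d + u * P ≤ Q * suc y
    upper with m≤n⇒m<n∨m≡n h2
    ... | inj₂ eq = *-cancelˡ-≤ q' (begin
          q' * (d + u * P) ≡⟨ *-distribˡ-+ q' d (u * P) ⟩
          q' * d + q' * (u * P) ≤⟨ +-monoˡ-≤ (q' * (u * P)) (*-monoˡ-≤ d (divisor-≤ hu1 cop (suc y) eq)) ⟩
          u * d + q' * (u * P) ≡⟨ trans (+-comm (u * d) _) key ⟩
          Q * (u * p') ≡⟨ cong (Q *_) eq ⟩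
          Q * (q' * suc y) ≡⟨ solve 3 (λ Q q' z → Q :* (q' :* z) := q' :* (Q :* z)) refl Q q' (suc y) ⟩
          q' * (Q * suc y) ∎)
    ... | inj₁ lt = *-cancelˡ-≤ q' (begin
          q' * (d + u * P) ≡⟨ *-distribˡ-+ q' d (u * P) ⟩
          q' * d + q' * (u * P) ≤⟨ +-monoˡ-≤ (q' * (u * P)) (subst (_≤ Q) (*-comm d q') dq′≤Q) ⟩
          Q + q' * (u * P) ≤⟨ +-monoʳ-≤ Q (m≤m+n _ (u * d)) ⟩
          Q + (q' * (u * P) + u * d) ≡⟨ cong (Q +_) key ⟩
          Q + Q * (u * p') ≡⟨ sym (*-suc Q (u * p')) ⟩
          Q * suc (u * p') ≤⟨ *-monoʳ-≤ Q lt ⟩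
          Q * (q' * suc y) ≡⟨ solve 3 (λ Q q' z → Q :* (q' :* z) := q' :* (Q :* z)) refl Q q' (suc y) ⟩
          q' * (Q * suc y) ∎)

  open import Data.Nat.Divisibility using (∣-trans; m∣m*n)

  suc-∸1-mul : ∀ P t → 1 ≤ P → suc (P ∸ 1 + t * P) ≡ suc t * P
  suc-∸1-mul (suc P0) t _ = refl

  -- The floors of multiples of P/Q over one period Q are those of p/q on the first
  -- dq steps (floor-head) and those of p′/q′, shifted by dp, on the last q′ steps
  -- (floor-tail).  The rounding offset (−1 or not) depends on the sign of the
  -- determinant p q′ − p′ q, which alternates with the parity of the index.
  module NextConvergent (p q p' q' d : ℕ) .{{nzq : NonZero q}} .{{nzq' : NonZero q'}} (hq'q : q' ≤ q) where
    P Q : ℕ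
    P = d * p + p'
    Q = d * q + q'

    q≥1 : 1 ≤ q
    q≥1 = >-nonZero⁻¹ q
    q'≥1 : 1 ≤ q'
    q'≥1 = >-nonZero⁻¹ q'

    instance
      nzQ : NonZero Q
      nzQ = >-nonZero (≤-trans q'≥1 (m≤n+m q' (d * q)))

    dq′≤Q : d * q' ≤ Q
    dq′≤Q = ≤-trans (*-monoʳ-≤ d hq'q) (m≤m+n (d * q) q')
    d+q′≤Q : d + q' ≤ Q
    d+q′≤Q = +-monoˡ-≤ q' (subst (_≤ d * q) (*-identityʳ d) (*-monoʳ-≤ d q≥1))

    head-index : ∀ t → t ≤ d * q → suc t ≤ Q
    head-index t le = subst (_≤ Q) (+-comm t 1) (+-mono-≤ le q'≥1)

    -- Determinant +1 (p/q a convergent of odd index).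
    module OddStep (det : p * q' ≡ p' * q + 1) where
      HpQ : p * Q ≡ P * q + 1
      HpQ = begin-equality
        p * (d * q + q') ≡⟨ solve 4 (λ p d q q' → p :* (d :* q :+ q') := d :* p :* q :+ p :* q') refl p d q q' ⟩
        d * p * q + p * q' ≡⟨ cong (d * p * q +_) det ⟩
        d * p * q + (p' * q + 1) ≡⟨ solve 4 (λ p d q p' → d :* p :* q :+ (p' :* q :+ con 1) := (d :* p :+ p') :* q :+ con 1) refl p d q p' ⟩
        (d * p + p') * q + 1 ∎
      HPq' : P * q' ≡ p' * Q + d
      HPq' = begin-equality
        (d * p + p') * q' ≡⟨ solve 4 (λ p d q' p' → (d :* p :+ p') :* q' := d :* (p :* q') :+ p' :* q') refl p d q' p' ⟩
        d * (p * q') + p' * q' ≡⟨ cong (λ z → d * z + p' * q') det ⟩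
        d * (p' * q + 1) + p' * q' ≡⟨ solve 4 (λ p' d q q' → d :* (p' :* q :+ con 1) :+ p' :* q' := p' :* (d :* q :+ q') :+ d) refl p' d q q' ⟩
        p' * (d * q + q') + d ∎
      p≥1 : 1 ≤ p
      p≥1 = n≢0⇒n>0 λ e → 0≢1+n (trans (sym (cong (_* q') e)) (trans det (+-comm (p' * q) 1)))

      floor-head : ∀ t → t ≤ d * q → (P + t * P) / Q ≡ (p ∸ 1 + t * p) / q
      floor-head t le = floor-unique (P + t * P) Q x (proj₁ r) (proj₂ r)
        where
        N = p ∸ 1 + t * p
        x = N / q
        sN : suc N ≡ suc t * p
        sN = suc-∸1-mul p t p≥1
        h1 : q * x + 1 ≤ suc t * p
        h1 = subst₂ _≤_ (+-comm 1 (q * x)) sN (s≤s (floor-lower N q))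
        h2 : suc t * p ≤ q * x + q
        h2 = subst₂ _≤_ sN (trans (*-suc q x) (+-comm q (q * x))) (floor-upper N q)
        r = head-bounds-odd p q P Q (suc t) x HpQ (s≤s z≤n) (head-index t le) h1 h2

      -- q′ and p′ are coprime, by the determinant identity.
      coprime-cancel : ∀ u → q' ∣ u * p' → q' ∣ u
      coprime-cancel u h = ∣m+n∣m⇒∣n (subst (q' ∣_) e (n∣m*n (u * p))) (∣-trans h (m∣m*n q))
        where
        e : u * p * q' ≡ u * p' * q + u
        e = trans (*-assoc u p q') (trans (cong (u *_) det) (solve 4 (λ u p' q x → u :* (p' :* q :+ con 1) := u :* p' :* q :+ u) refl u p' q 0))

      floor-tail : ∀ t → t ≤ q' → (P + (d * q + t) * P) / Q ≡ d * p + (p' + t * p') / q'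
      floor-tail t le = floor-unique (P + (d * q + t) * P) Q (d * p + y) lower upper
        where
        y = (suc t * p') / q'
        h1 : q' * y ≤ suc t * p'
        h1 = floor-lower (suc t * p') q'
        h2 : suc t * p' + 1 ≤ q' * suc y
        h2 = subst (_≤ q' * suc y) (+-comm 1 (suc t * p')) (floor-upper (suc t * p') q')
        r = tail-bounds-odd p' q' P Q (suc t) y d HPq' (s≤s z≤n) (s≤s le) dq′≤Q d+q′≤Q (coprime-cancel (suc t)) h1 h2
        E1 : Q * (d * p + y) ≡ d * q * P + (Q * y + d)
        E1 = begin-equality
          Q * (d * p + y) ≡⟨ solve 4 (λ Q d p y → Q :* (d :* p :+ y) := d :* (p :* Q) :+ Q :* y) refl Q d p y ⟩
          d * (p * Q) + Q * y ≡⟨ cong (λ z → d * z + Q * y) HpQ ⟩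
          d * (P * q + 1) + Q * y ≡⟨ solve 5 (λ d P q Q y → d :* (P :* q :+ con 1) :+ Q :* y := d :* q :* P :+ (Q :* y :+ d)) refl d P q Q y ⟩
          d * q * P + (Q * y + d) ∎
        E2 : P + (d * q + t) * P ≡ d * q * P + (P + t * P)
        E2 = solve 4 (λ P d q t → P :+ (d :* q :+ t) :* P := d :* q :* P :+ (P :+ t :* P)) refl P d q t
        lower : Q * (d * p + y) ≤ P + (d * q + t) * P
        lower = subst₂ _≤_ (sym E1) (sym E2) (+-monoʳ-≤ (d * q * P) (proj₁ r))
        upper : P + (d * q + t) * P < Q * suc (d * p + y)
        upper = subst₂ _≤_ (trans (+-suc (d * q * P) (suc t * P)) (cong suc (sym E2))) E3 (+-monoʳ-≤ (d * q * P) (subst (_≤ Q * y + Q + d) (+-comm (suc t * P) 1) (proj₂ r)))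
          where
          E3 : d * q * P + (Q * y + Q + d) ≡ Q * suc (d * p + y)
          E3 = trans (solve 5 (λ A Qy Q d x → A :+ (Qy :+ Q :+ d) := (A :+ (Qy :+ d)) :+ Q) refl (d * q * P) (Q * y) Q d 0)
               (trans (cong (_+ Q) (sym E1)) (trans (+-comm _ Q) (sym (*-suc Q (d * p + y)))))

    -- Determinant −1 (p/q a convergent of even index).
    module EvenStep (det : p' * q ≡ p * q' + 1) where
      HPq : P * q ≡ p * Q + 1
      HPq = begin-equality
        (d * p + p') * q ≡⟨ solve 4 (λ p d q p' → (d :* p :+ p') :* q := d :* p :* q :+ p' :* q) refl p d q p' ⟩
        d * p * q + p' * q ≡⟨ cong (d * p * q +_) det ⟩
        d * p * q + (p * q' + 1) ≡⟨ solve 4 (λ p d q q' → d :* p :* q :+ (p :* q' :+ con 1) := p :* (d :* q :+ q') :+ con 1) refl p d q q' ⟩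
        p * (d * q + q') + 1 ∎
      Hp'Q : p' * Q ≡ P * q' + d
      Hp'Q = begin-equality
        p' * (d * q + q') ≡⟨ solve 4 (λ p' d q q' → p' :* (d :* q :+ q') := d :* (p' :* q) :+ p' :* q') refl p' d q q' ⟩
        d * (p' * q) + p' * q' ≡⟨ cong (λ z → d * z + p' * q') det ⟩
        d * (p * q' + 1) + p' * q' ≡⟨ solve 4 (λ p d q' p' → d :* (p :* q' :+ con 1) :+ p' :* q' := (d :* p :+ p') :* q' :+ d) refl p d q' p' ⟩
        (d * p + p') * q' + d ∎
      p'≥1 : 1 ≤ p'
      p'≥1 = n≢0⇒n>0 λ e → 0≢1+n (trans (sym (cong (_* q) e)) (trans det (+-comm (p * q') 1)))
      P≥1 : 1 ≤ P
      P≥1 = ≤-trans p'≥1 (m≤n+m p' (d * p))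

      floor-head : ∀ t → t ≤ d * q → (P ∸ 1 + t * P) / Q ≡ (p + t * p) / q
      floor-head t le = floor-unique N Q x lo' hi'
        where
        x = (suc t * p) / q
        N = P ∸ 1 + t * P
        sN : suc N ≡ suc t * P
        sN = suc-∸1-mul P t P≥1
        h1 : q * x ≤ suc t * p
        h1 = floor-lower (suc t * p) q
        h2 : suc t * p + 1 ≤ q * suc x
        h2 = subst (_≤ q * suc x) (+-comm 1 (suc t * p)) (floor-upper (suc t * p) q)
        r = head-bounds-even p q P Q (suc t) x HPq (s≤s z≤n) (head-index t le) h1 h2
        lo' : Q * x ≤ N
        lo' = ≤-pred (subst₂ _≤_ (+-comm (Q * x) 1) (sym sN) (proj₁ r))
        hi' : N < Q * suc x
        hi' = subst (_≤ Q * suc x) (sym sN) (proj₂ r)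

      -- q′ and p′ are coprime, by the determinant identity.
      coprime-cancel : ∀ u → q' ∣ u * p' → q' ∣ u
      coprime-cancel u h = ∣m+n∣m⇒∣n (subst (q' ∣_) e (∣-trans h (m∣m*n q))) (n∣m*n (u * p))
        where
        e : u * p' * q ≡ u * p * q' + u
        e = trans (*-assoc u p' q) (trans (cong (u *_) det) (solve 4 (λ u p q' x → u :* (p :* q' :+ con 1) := u :* p :* q' :+ u) refl u p q' 0))

      floor-tail : ∀ t → t ≤ q' → (P ∸ 1 + (d * q + t) * P) / Q ≡ d * p + (p' ∸ 1 + t * p') / q'
      floor-tail t le = floor-unique N Q (d * p + y) lower upper
        where
        Np = p' ∸ 1 + t * p'
        y = Np / q'
        sNp : suc Np ≡ suc t * p'
        sNp = suc-∸1-mul p' t p'≥1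
        h1 : q' * y + 1 ≤ suc t * p'
        h1 = subst₂ _≤_ (+-comm 1 (q' * y)) sNp (s≤s (floor-lower Np q'))
        h2 : suc t * p' ≤ q' * suc y
        h2 = subst (_≤ q' * suc y) sNp (floor-upper Np q')
        r = tail-bounds-even p' q' P Q (suc t) y d Hp'Q (s≤s z≤n) (s≤s le) dq′≤Q d+q′≤Q (coprime-cancel (suc t)) h1 h2
        N = P ∸ 1 + (d * q + t) * P
        sN : suc N ≡ d * q * P + suc t * P
        sN = trans (suc-∸1-mul P (d * q + t) P≥1) (solve 4 (λ P d q t → (con 1 :+ (d :* q :+ t)) :* P := d :* q :* P :+ (P :+ t :* P)) refl P d q t)
        E1 : Q * (d * p + y) + d ≡ d * q * P + Q * y
        E1 = begin-equality
          Q * (d * p + y) + d ≡⟨ solve 4 (λ Q d p y → Q :* (d :* p :+ y) :+ d := d :* (p :* Q :+ con 1) :+ Q :* y) refl Q d p y ⟩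
          d * (p * Q + 1) + Q * y ≡⟨ cong (λ z → d * z + Q * y) (sym HPq) ⟩
          d * (P * q) + Q * y ≡⟨ solve 5 (λ d P q Q y → d :* (P :* q) :+ Q :* y := d :* q :* P :+ Q :* y) refl d P q Q y ⟩
          d * q * P + Q * y ∎
        lower : Q * (d * p + y) ≤ N
        lower = ≤-pred (+-cancelʳ-≤ d _ _ (begin
          suc (Q * (d * p + y)) + d ≡⟨ cong suc E1 ⟩
          suc (d * q * P + Q * y) ≡⟨ trans (sym (+-suc (d * q * P) (Q * y))) (cong (d * q * P +_) (+-comm 1 (Q * y))) ⟩
          d * q * P + (Q * y + 1) ≤⟨ +-monoʳ-≤ (d * q * P) (proj₁ r) ⟩
          d * q * P + (d + suc t * P) ≡⟨ solve 3 (λ A d B → A :+ (d :+ B) := A :+ B :+ d) refl (d * q * P) d (suc t * P) ⟩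
          d * q * P + suc t * P + d ≡⟨ cong (_+ d) (sym sN) ⟩
          suc N + d ∎))
        upper : N < Q * suc (d * p + y)
        upper = +-cancelʳ-≤ d _ _ (begin
          suc N + d ≡⟨ cong (_+ d) sN ⟩
          d * q * P + suc t * P + d ≡⟨ solve 3 (λ A d B → A :+ B :+ d := A :+ (d :+ B)) refl (d * q * P) d (suc t * P) ⟩
          d * q * P + (d + suc t * P) ≤⟨ +-monoʳ-≤ (d * q * P) (proj₂ r) ⟩
          d * q * P + Q * suc y ≡⟨ cong (d * q * P +_) (*-suc Q y) ⟩
          d * q * P + (Q + Q * y) ≡⟨ solve 3 (λ A Q B → A :+ (Q :+ B) := (A :+ B) :+ Q) refl (d * q * P) Q (Q * y) ⟩
          d * q * P + Q * y + Q ≡⟨ cong (_+ Q) (sym E1) ⟩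
          Q * (d * p + y) + d + Q ≡⟨ solve 3 (λ A d Q → A :+ d :+ Q := Q :+ A :+ d) refl (Q * (d * p + y)) d Q ⟩
          Q + Q * (d * p + y) + d ≡⟨ cong (_+ d) (sym (*-suc Q (d * p + y))) ⟩
          Q * suc (d * p + y) + d ∎)


-- Jump words: the letter at position t records whether f jumps between t−1 and t.
-- Mechanical words are the jump words of t ↦ ⌊tθ + ρ⌋ (or ⌈tθ + ρ⌉).
module JumpWords (a b : ℕ) where

  open import Data.Nat
  open import Data.Nat.Properties
  open import Data.Nat.DivMod
  open import Data.Integer as ℤ using (ℤ; +_)
  import Data.Integer.Properties as ℤP
  open import Algebra.Bundles using (AbelianGroup)
  open import Algebra.Properties.Group (AbelianGroup.group ℤP.+-0-abelianGroup) using (∙-cancelʳ)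
  open import Data.List using (List; []; _∷_; _++_)
  open import Relation.Binary.PropositionalEquality
  open import Relation.Nullary using (yes; no)
  open import Data.Empty using (⊥-elim)
  open import Data.Nat.Divisibility using (n∣m*n)

  jumpWord : (ℕ → ℕ) → ℕ → ℕ → List ℕ
  jumpWord f i zero = []
  jumpWord f i (suc n) = letter a b (+ f (suc i)) (+ f i) ∷ jumpWord f (suc i) n

  letter-cong : ∀ (m m' n n' : ℤ) → (m ≡ m' → n ≡ n') → (n ≡ n' → m ≡ m') → letter a b m m' ≡ letter a b n n'
  letter-cong m m' n n' f g with m ℤ.≟ m' | n ℤ.≟ n'
  ... | yes _ | yes _ = refl
  ... | no _ | no _ = refl
  ... | yes e | no ne = ⊥-elim (ne (f e))
  ... | no ne | yes e = ⊥-elim (ne (g e))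

  letter-shift : ∀ x y k → letter a b (x ℤ.+ k) (y ℤ.+ k) ≡ letter a b x y
  letter-shift x y k = letter-cong _ _ _ _ (∙-cancelʳ k x y) (cong (ℤ._+ k))

  jumpWord-const : ∀ i n → jumpWord (λ _ → 0) i n ≡ (a ∷ []) ^w n
  jumpWord-const i zero = refl
  jumpWord-const i (suc n) = cong (a ∷_) (jumpWord-const (suc i) n)

  jumpWord-shift : ∀ (f g : ℕ → ℕ) C i j n → (∀ t → t ≤ n → f (i + t) ≡ g (j + t) + C) → jumpWord f i n ≡ jumpWord g j n
  jumpWord-shift f g C i j zero h = refl
  jumpWord-shift f g C i j (suc n) h = cong₂ _∷_ hd (jumpWord-shift f g C (suc i) (suc j) n h')
    where
    e1 : f (suc i) ≡ g (suc j) + C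
    e1 = subst₂ (λ u v → f u ≡ g v + C) (+-comm i 1) (+-comm j 1) (h 1 (s≤s z≤n))
    e0 : f i ≡ g j + C
    e0 = subst₂ (λ u v → f u ≡ g v + C) (+-identityʳ i) (+-identityʳ j) (h 0 z≤n)
    hd : letter a b (+ f (suc i)) (+ f i) ≡ letter a b (+ g (suc j)) (+ g j)
    hd = trans (cong₂ (λ u v → letter a b (+ u) (+ v)) e1 e0) (letter-shift (+ g (suc j)) (+ g j) (+ C))
    h' : ∀ t → t ≤ n → f (suc i + t) ≡ g (suc j + t) + C
    h' t le = subst₂ (λ u v → f u ≡ g v + C) (+-suc i t) (+-suc j t) (h (suc t) (s≤s le))

  jumpWord-++ : ∀ f i m n → jumpWord f i (m + n) ≡ jumpWord f i m ++ jumpWord f (i + m) n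
  jumpWord-++ f i zero n = cong (λ z → jumpWord f z n) (sym (+-identityʳ i))
  jumpWord-++ f i (suc m) n = cong (_ ∷_) (trans (jumpWord-++ f (suc i) m n) (cong (λ z → jumpWord f (suc i) m ++ jumpWord f z n) (sym (+-suc i m))))

  -- The rotation t ↦ ⌊(c + tp)/q⌋ gains p every q steps, so its jump word is q-periodic.
  module Periodic (c p q : ℕ) .{{nz : NonZero q}} where
    F : ℕ → ℕ
    F t = (c + t * p) / q

    F-period : ∀ t → F (t + q) ≡ F t + p
    F-period t = trans (cong (_/ q) e) (trans (+-distrib-/-∣ʳ (c + t * p) (n∣m*n p)) (cong (λ z → F t + z) (m*n/n≡m p q)))
      where
      open import Data.Nat.Solver using (module +-*-Solver)
      open +-*-Solver
      e : c + (t + q) * p ≡ (c + t * p) + p * q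
      e = solve 4 (λ c t q p → c :+ (t :+ q) :* p := (c :+ t :* p) :+ p :* q) refl c t q p

    jumpWord-period : ∀ i n → jumpWord F (i + q) n ≡ jumpWord F i n
    jumpWord-period i n = jumpWord-shift F F p (i + q) i n (λ t _ → trans (cong F (trans (+-assoc i q t) (trans (cong (λ z → i + z) (+-comm q t)) (sym (+-assoc i t q))))) (F-period (i + t)))

    jumpWord-periods : ∀ j i n → jumpWord F (j * q + i) n ≡ jumpWord F i n
    jumpWord-periods zero i n = refl
    jumpWord-periods (suc j) i n = trans (cong (λ z → jumpWord F z n) e) (trans (jumpWord-period (j * q + i) n) (jumpWord-periods j i n))
      where
      e : suc j * q + i ≡ (j * q + i) + q
      e = trans (+-assoc q (j * q) i) (+-comm q (j * q + i))

    jumpWord-power : ∀ j → jumpWord F 0 (j * q) ≡ jumpWord F 0 q ^w j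
    jumpWord-power zero = refl
    jumpWord-power (suc j) = trans (jumpWord-++ F 0 q (j * q)) (cong (jumpWord F 0 q ++_) (trans (jumpWord-period 0 (j * q)) (jumpWord-power j)))

-- The standard words are jump words of rational rotations: with p/q = p_K/q_K,
-- M_K is the jump word over one period of t ↦ ⌊(p − 1 + tp)/q⌋ for odd K and of
-- t ↦ ⌊(p + tp)/q⌋ for even K.
module StandardJumpWords (a b : ℕ) (d : ℕ → ℕ) (hd : PositiveQuotients d) where
  open JumpWords a b
  open FloorArithmetic
  open import Data.Nat
  open import Data.Nat.Properties
  open import Data.Nat.DivMod
  open import Data.Integer as ℤ using (ℤ; +_)
  open import Data.List using (List; []; _∷_; _++_)
  open import Relation.Binary.PropositionalEquality
  open import Data.Product using (∃; _×_; _,_; proj₁; proj₂)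

  nzq : ∀ K → NonZero (qc d K)
  nzq K = >-nonZero (qc-pos d K)

  rotation : ℕ → ℕ → ℕ → ℕ
  rotation K c t = _/_ (c + t * pc d K) (qc d K) {{nzq K}}

  Fo Fe : ℕ → ℕ → ℕ
  Fo K = rotation K (pc d K ∸ 1)
  Fe K = rotation K (pc d K)

  StandardOdd StandardEven detOdd detEven : ℕ → Set
  StandardOdd K = jumpWord (Fo K) 0 (qc d K) ≡ Mw a b d (suc K)
  StandardEven K = jumpWord (Fe K) 0 (qc d K) ≡ Mw a b d (suc K)
  detOdd k = pc d (suc k) * qc d k ≡ pc d k * qc d (suc k) + 1
  detEven k = pc d k * qc d (suc k) ≡ pc d (suc k) * qc d k + 1

  q-mono : ∀ K → qc d K ≤ qc d (suc K)
  q-mono zero = s≤s z≤n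
  q-mono (suc k) = ≤-trans (subst (_≤ d (suc (suc k)) * qc d (suc k)) (*-identityˡ (qc d (suc k)))
                     (*-monoˡ-≤ (qc d (suc k)) (hd (suc (suc k)) (s≤s z≤n)))) (m≤m+n _ (qc d k))

  q-mono-≤ : ∀ {x y} → x ≤ y → qc d x ≤ qc d y
  q-mono-≤ x≤y = chain (≤⇒≤′ x≤y)
    where
    chain : ∀ {x y} → x ≤′ y → qc d x ≤ qc d y
    chain ≤′-refl = ≤-refl
    chain (≤′-step {n = y} x≤′y) = ≤-trans (chain x≤′y) (q-mono y)

  module Step (k : ℕ) = NextConvergent (pc d (suc k)) (qc d (suc k)) (pc d k) (qc d k) (d (suc (suc k))) {{nzq (suc k)}} {{nzq k}} (q-mono k)

  -- M_{k+2} = M_{k+1}^{d} M_k: the head of the rotation by p_{k+2}/q_{k+2} repeats that of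
  -- p_{k+1}/q_{k+1} d times, its tail is that of p_k/q_k (floor-head, floor-tail).
  odd-step : ∀ k → detOdd k → StandardOdd (suc k) → StandardEven k → StandardEven (suc (suc k))
  odd-step k det Io Ie = trans (jumpWord-++ F' 0 (dd * q) q') (cong₂ _++_ first second)
    where
    open Step k
    open OddStep det
    dd = d (suc (suc k))
    p = pc d (suc k)
    q = qc d (suc k)
    p' = pc d k
    q' = qc d k
    F' = Fe (suc (suc k))
    first : jumpWord F' 0 (dd * q) ≡ Mw a b d (suc (suc k)) ^w dd
    first = trans (jumpWord-shift F' (Fo (suc k)) 0 0 0 (dd * q) (λ t le → trans (floor-head t le) (sym (+-identityʳ _))))
            (trans (Periodic.jumpWord-power (p ∸ 1) p q {{nzq (suc k)}} dd) (cong (_^w dd) Io))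
    second : jumpWord F' (dd * q) q' ≡ Mw a b d (suc k)
    second = trans (jumpWord-shift F' (Fe k) (dd * p) (dd * q) 0 q' (λ t le → trans (floor-tail t le) (+-comm (dd * p) _))) Ie

  even-step : ∀ k → detEven k → StandardEven (suc k) → StandardOdd k → StandardOdd (suc (suc k))
  even-step k det Ie Io = trans (jumpWord-++ F' 0 (dd * q) q') (cong₂ _++_ first second)
    where
    open Step k
    open EvenStep det
    dd = d (suc (suc k))
    p = pc d (suc k)
    q = qc d (suc k)
    p' = pc d k
    q' = qc d k
    F' = Fo (suc (suc k))
    first : jumpWord F' 0 (dd * q) ≡ Mw a b d (suc (suc k)) ^w dd
    first = trans (jumpWord-shift F' (Fe (suc k)) 0 0 0 (dd * q) (λ t le → trans (floor-head t le) (sym (+-identityʳ _))))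
            (trans (Periodic.jumpWord-power p p q {{nzq (suc k)}} dd) (cong (_^w dd) Ie))
    second : jumpWord F' (dd * q) q' ≡ Mw a b d (suc k)
    second = trans (jumpWord-shift F' (Fo k) (dd * p) (dd * q) 0 q' (λ t le → trans (floor-tail t le) (+-comm (dd * p) _))) Io

  standard-base : StandardOdd 1
  standard-base = trans (cong (jumpWord (Fo 1) 0) (+-comm 1 (d 1))) (trans (jumpWord-++ (Fo 1) 0 (d 1) 1) (cong₂ _++_ part1 part2))
    where
    instance
      _ : NonZero (suc (d 1))
      _ = _
    part1 : jumpWord (Fo 1) 0 (d 1) ≡ (a ∷ []) ^w d 1
    part1 = trans (jumpWord-shift (Fo 1) (λ _ → 0) 0 0 0 (d 1) (λ t le → m<n⇒m/n≡0 (s≤s (subst (_≤ d 1) (sym (*-identityʳ t)) le)))) (jumpWord-const 0 (d 1))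
    e1 : Fo 1 (suc (d 1)) ≡ 1
    e1 = trans (cong (_/ suc (d 1)) (*-identityʳ (suc (d 1)))) (n/n≡1 (suc (d 1)))
    e0 : Fo 1 (d 1) ≡ 0
    e0 = m<n⇒m/n≡0 (s≤s (≤-reflexive (*-identityʳ (d 1))))
    part2 : jumpWord (Fo 1) (d 1) 1 ≡ b ∷ []
    part2 = cong₂ (λ u v → letter a b (+ u) (+ v) ∷ []) e1 e0

  -- double m = 2m; the induction runs over pairs (2m, 2m+1) of indices.
  double : ℕ → ℕ
  double zero = zero
  double (suc m) = suc (suc (double m))

  m≤double : ∀ m → m ≤ double m
  m≤double zero = z≤n
  m≤double (suc m) = s≤s (≤-trans (m≤double m) (n≤1+n _))

  standard-words : ∀ m → StandardEven (double m) × StandardOdd (suc (double m)) × detOdd (double m)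
  standard-words zero = refl , standard-base , refl
  standard-words (suc m) with standard-words m
  ... | Ie , Io , det = Ie2 , Io3 , det3
    where
    k = double m
    Ie2 : StandardEven (suc (suc k))
    Ie2 = odd-step k det Io Ie
    det2 : detEven (suc k)
    det2 = Step.OddStep.HpQ k det
    Io3 : StandardOdd (suc (suc (suc k)))
    Io3 = even-step (suc k) det2 Ie2 Io
    det3 : detOdd (suc (suc k))
    det3 = Step.EvenStep.HPq (suc k) det2

  module SquareFactors (m : ℕ) where
    K = suc (double m)
    p = pc d K
    q = qc d K
    p' = pc d (double m)
    q' = qc d (double m)
    instance
      nzK : NonZero q
      nzK = nzq K

    det : p * q' ≡ p' * q + 1
    det = proj₂ (proj₂ (standard-words m))

    M : List ℕ
    M = Mw a b d (suc K)

    p≥1 : 1 ≤ p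
    p≥1 = n≢0⇒n>0 λ e → 0≢1+n (trans (sym (cong (_* q') e)) (trans det (+-comm (p' * q) 1)))

    Fc : ℕ → ℕ → ℕ
    Fc = rotation K

    FoK : ℕ → ℕ
    FoK = Fo K

    normalise-start : ∀ c i n → jumpWord (Fc c) i n ≡ jumpWord (Fc ((c + i * p) % q)) 0 n
    normalise-start c i n = jumpWord-shift (Fc c) (Fc r) ((c + i * p) / q) i 0 n h
      where
      open import Data.Nat.Solver using (module +-*-Solver)
      open +-*-Solver
      c' = c + i * p
      r = c' % q
      h : ∀ t → t ≤ n → Fc c (i + t) ≡ Fc r (0 + t) + c' / q
      h t _ = trans (cong (_/ q) e) (/-+-multiple (r + t * p) (c' / q) q)
        where
        e : c + (i + t) * p ≡ (r + t * p) + (c' / q) * q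
        e = trans (solve 4 (λ c i t p → c :+ (i :+ t) :* p := (c :+ i :* p) :+ t :* p) refl c i t p)
             (trans (cong (_+ t * p) (m≡m%n+[m/n]*n c' q))
               (solve 3 (λ r t z → r :+ z :+ t := r :+ t :+ z) refl r (t * p) ((c' / q) * q)))

    -- Every intercept occurs in the rotation defining M_K: as pq′ ≡ 1 (mod q), shifting
    -- the start by a suitable multiple o of q′ changes the intercept (p − 1)/q into r/q.
    align-phase : ∀ r n → ∃ λ o → jumpWord (Fc r) 0 n ≡ jumpWord FoK o n
    align-phase r n = o , sym (jumpWord-shift FoK (Fc r) Z o 0 n h)
      where
      pm = pred p
      qm = pred q
      ep : p ≡ suc pm
      ep = sym (suc-pred p {{>-nonZero p≥1}})
      eq : q ≡ suc qm
      eq = sym (suc-pred q)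
      open import Data.Nat.Solver using (module +-*-Solver)
      open +-*-Solver
      T = r + qm * pm
      o = T * q'
      Z = pm + T * p'
      h : ∀ t → t ≤ n → FoK (o + t) ≡ Fc r (0 + t) + Z
      h t _ = trans (cong (_/ q) e) (/-+-multiple (r + t * p) Z q)
        where
        e : p ∸ 1 + (o + t) * p ≡ (r + t * p) + Z * q
        e = begin
          p ∸ 1 + (o + t) * p ≡⟨ cong (λ z → z ∸ 1 + (o + t) * z) ep ⟩
          pm + (T * q' + t) * suc pm ≡⟨ solve 4 (λ pm T q' t → pm :+ (T :* q' :+ t) :* (con 1 :+ pm) := pm :+ T :* ((con 1 :+ pm) :* q') :+ t :* (con 1 :+ pm)) refl pm T q' t ⟩
          pm + T * (suc pm * q') + t * suc pm ≡⟨ cong (λ z → pm + T * (z * q') + t * z) (sym ep) ⟩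
          pm + T * (p * q') + t * p ≡⟨ cong (λ z → pm + T * z + t * p) det ⟩
          pm + T * (p' * q + 1) + t * p ≡⟨ cong (λ z → pm + T * (p' * z + 1) + t * p) eq ⟩
          pm + T * (p' * suc qm + 1) + t * p ≡⟨ solve 6 (λ pm r qm p' tp x → pm :+ (r :+ qm :* pm) :* (p' :* (con 1 :+ qm) :+ con 1) :+ tp
                                                   := (r :+ tp) :+ (pm :+ (r :+ qm :* pm) :* p') :* (con 1 :+ qm)) refl pm r qm p' (t * p) 0 ⟩
          (r + t * p) + Z * suc qm ≡⟨ cong (λ z → (r + t * p) + Z * z) (sym eq) ⟩
          (r + t * p) + Z * q ∎
          where open ≡-Reasoning

    reduce-start : ∀ o n → jumpWord FoK o n ≡ jumpWord FoK (o % q) n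
    reduce-start o n = trans (cong (λ z → jumpWord FoK z n) (trans (m≡m%n+[m/n]*n o q) (+-comm (o % q) _))) (Periodic.jumpWord-periods (p ∸ 1) p q ((o / q)) (o % q) n)

    window-in-square : ∀ o n → o < q → n ≤ q → FactorOf (jumpWord FoK o n) (M ++ M)
    window-in-square o n lo ln = jumpWord FoK 0 o , jumpWord FoK (o + n) e , sym chain
      where
      e = (q + q) ∸ (o + n)
      le : o + n ≤ q + q
      le = +-mono-≤ (<⇒≤ lo) ln
      open ≡-Reasoning
      chain : jumpWord FoK 0 o ++ jumpWord FoK o n ++ jumpWord FoK (o + n) e ≡ M ++ M
      chain = begin
        jumpWord FoK 0 o ++ jumpWord FoK o n ++ jumpWord FoK (o + n) e ≡⟨ cong (jumpWord FoK 0 o ++_) (sym (jumpWord-++ FoK o n e)) ⟩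
        jumpWord FoK 0 o ++ jumpWord FoK o (n + e) ≡⟨ sym (jumpWord-++ FoK 0 o (n + e)) ⟩
        jumpWord FoK 0 (o + (n + e)) ≡⟨ cong (jumpWord FoK 0) (trans (sym (+-assoc o n e)) (m+[n∸m]≡n le)) ⟩
        jumpWord FoK 0 (q + q) ≡⟨ jumpWord-++ FoK 0 q q ⟩
        jumpWord FoK 0 q ++ jumpWord FoK q q ≡⟨ cong (jumpWord FoK 0 q ++_) (Periodic.jumpWord-period (p ∸ 1) p q 0 q) ⟩
        jumpWord FoK 0 q ++ jumpWord FoK 0 q ≡⟨ cong₂ _++_ io io ⟩
        M ++ M ∎
        where
        io : jumpWord FoK 0 q ≡ M
        io = proj₁ (proj₂ (standard-words m))

    jump-window-in-square : ∀ c i n → n ≤ q → FactorOf (jumpWord (Fc c) i n) (M ++ M)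
    jump-window-in-square c i n ln with align-phase ((c + i * p) % q) n
    ... | o , eo = subst (λ w → FactorOf w (M ++ M)) (sym (trans (normalise-start c i n) (trans eo (reduce-start o n))))
                     (window-in-square (o % q) n (m%n<n o q) ln)

module IntegerEmbedding where

  open import Data.Nat as ℕ using (ℕ; suc; NonZero)
  open import Data.Integer as ℤ using (ℤ; +_)
  import Data.Integer.Properties as ℤP
  import Data.Nat.Properties as NP
  open import Data.Rational as ℚ using (ℚ; _/_; 1ℚ; 0ℚ; toℚᵘ)
  import Data.Rational.Properties as ℚP
  open import Data.Rational.Unnormalised as ℚᵘ using (mkℚᵘ; *≡*; *<*)
  import Data.Rational.Unnormalised.Properties as ℚᵘP
  open import Relation.Binary.PropositionalEquality
  open import Data.Integer.Solver using (module +-*-Solver)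
  open +-*-Solver

  toℚᵘ-ℚ[] : ∀ a → toℚᵘ ℚ[ a ] ℚᵘ.≃ mkℚᵘ a 0
  toℚᵘ-ℚ[] a = ℚP.toℚᵘ-fromℚᵘ (mkℚᵘ a 0)

  ℚ[]-+ : ∀ a b → ℚ[ a ] ℚ.+ ℚ[ b ] ≡ ℚ[ a ℤ.+ b ]
  ℚ[]-+ a b = ℚP.toℚᵘ-injective (ℚᵘP.≃-trans (ℚP.toℚᵘ-homo-+ ℚ[ a ] ℚ[ b ])
    (ℚᵘP.≃-trans (ℚᵘP.+-cong (toℚᵘ-ℚ[] a) (toℚᵘ-ℚ[] b)) (ℚᵘP.≃-trans (*≡* e) (ℚᵘP.≃-sym (toℚᵘ-ℚ[] (a ℤ.+ b))))))
    where
    e : (a ℤ.* + 1 ℤ.+ b ℤ.* + 1) ℤ.* + 1 ≡ (a ℤ.+ b) ℤ.* + 1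
    e = solve 2 (λ a b → (a :* con (+ 1) :+ b :* con (+ 1)) :* con (+ 1) := (a :+ b) :* con (+ 1)) refl a b

  ℚ[]-neg : ∀ a → ℚ.- ℚ[ a ] ≡ ℚ[ ℤ.- a ]
  ℚ[]-neg a = ℚP.toℚᵘ-injective (ℚᵘP.≃-trans (ℚP.toℚᵘ-homo‿- ℚ[ a ])
    (ℚᵘP.≃-trans (ℚᵘP.-‿cong (toℚᵘ-ℚ[] a)) (ℚᵘP.≃-sym (toℚᵘ-ℚ[] (ℤ.- a)))))

  ℚ[]-- : ∀ a b → ℚ[ a ] ℚ.- ℚ[ b ] ≡ ℚ[ a ℤ.- b ]
  ℚ[]-- a b = trans (cong (ℚ[ a ] ℚ.+_) (ℚ[]-neg b)) (ℚ[]-+ a (ℤ.- b))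

  <-cross-multiply : ∀ A B p q .{{_ : NonZero q}} → ℚ[ A ] ℚ.< ℚ[ B ] ℚ.* (+ p / q) → A ℤ.* + q ℤ.< B ℤ.* + p
  <-cross-multiply A B p (suc q0) h with ℚP.toℚᵘ-mono-< h
  ... | h' = lem (ℚᵘP.<-respʳ-≃ e2 (ℚᵘP.<-respˡ-≃ (toℚᵘ-ℚ[] A) h'))
    where
    e2 : toℚᵘ (ℚ[ B ] ℚ.* (+ p / suc q0)) ℚᵘ.≃ mkℚᵘ (B ℤ.* + p) q0
    e2 = ℚᵘP.≃-trans (ℚP.toℚᵘ-homo-* ℚ[ B ] (+ p / suc q0)) (ℚᵘP.≃-trans (ℚᵘP.*-cong (toℚᵘ-ℚ[] B) (ℚP.toℚᵘ-fromℚᵘ (mkℚᵘ (+ p) q0)))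
         (*≡* (cong (λ z → (B ℤ.* + p) ℤ.* + suc z) (sym (NP.+-identityʳ q0)))))
    lem : mkℚᵘ A 0 ℚᵘ.< mkℚᵘ (B ℤ.* + p) q0 → A ℤ.* + suc q0 ℤ.< B ℤ.* + p
    lem (*<* x) = subst (A ℤ.* + suc q0 ℤ.<_) (ℤP.*-identityʳ (B ℤ.* + p)) x


module SlopeApproximation where

  open IntegerEmbedding
  open import Data.Nat as ℕ using (ℕ)
  open import Data.Integer as ℤ using (ℤ; +_)
  open import Data.Rational as ℚ using (ℚ; 1ℚ; 0ℚ; _<_; _≤_; _+_; _*_; _-_; -_)
  open import Data.Rational.Properties
  open import Relation.Binary.PropositionalEquality hiding (J)
  open import Relation.Binary.Definitions using (tri<; tri≈; tri>)
  open import Relation.Nullary using (¬_; yes; no)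
  open import Data.Empty using (⊥-elim)
  open import Data.Product using (∃; _×_; _,_; proj₁; proj₂)
  open import Data.Rational.Solver using (module +-*-Solver)
  open +-*-Solver

  <⇒diff-neg : ∀ {p q} → p < q → p - q < 0ℚ
  <⇒diff-neg {p} {q} h = subst (p - q <_) (+-inverseʳ q) (+-monoˡ-< (- q) h)

  ≤⇒diff-nonpos : ∀ {p q} → p ≤ q → p - q ≤ 0ℚ
  ≤⇒diff-nonpos {p} {q} h = subst (p - q ≤_) (+-inverseʳ q) (+-monoˡ-≤ (- q) h)

  diff-neg⇒< : ∀ {x y} → x - y < 0ℚ → x < y
  diff-neg⇒< {x} {y} h = subst₂ _<_ (solve 2 (λ x y → x :- y :+ y := x) refl x y) (+-identityˡ y) (+-monoˡ-< y h)

  <⇒diff-pos : ∀ {x y} → x < y → 0ℚ < y - x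
  <⇒diff-pos {x} {y} h = subst (_< y - x) (+-inverseʳ x) (+-monoˡ-< (- x) h)

  ℚℕ-nonNeg : ∀ j → ℚ.NonNegative (ℚℕ j)
  ℚℕ-nonNeg j = normalize-nonNeg j 1

  module CloseToConvergent (θ ρ : ℝ) (T ε θu : ℚ) (hε : 0ℚ < ε) (hl : L θ (T - ε)) (hu : ¬ L θ θu) (hu' : θu < T + ε) where

    below-upper : ∀ s → L θ s → s ≤ T + ε
    below-upper s Ls with <-cmp s θu
    ... | tri< lt _ _ = <⇒≤ (<-trans lt hu')
    ... | tri≈ _ e _ = ⊥-elim (hu (subst (L θ) e Ls))
    ... | tri> _ _ gt = ⊥-elim (hu (downward θ θu s gt Ls))

    raise-witness : ∀ s → L θ s → ∃ λ s' → L θ s' × s ≤ s' × T - ε ≤ s'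
    raise-witness s Ls with s ≤? (T - ε)
    ... | yes h = T - ε , hl , h , ≤-refl
    ... | no h = s , Ls , ≤-refl , <⇒≤ (≰⇒> h)

    scale-mono : ∀ j {a b} → a ≤ b → ℚℕ j * a ≤ ℚℕ j * b
    scale-mono j = *-monoˡ-≤-nonNeg (ℚℕ j) {{ℚℕ-nonNeg j}}

    -- For m = ⌊jθ + ρ⌋ and m′ = ⌊j′θ + ρ⌋ (j′θ + ρ < r₀ ≤ m′ + 1 − η):
    -- adding the defining inequalities and |θ − T| < ε gives m − m′ − 1 < (j − j′)T.
    gap-bound-floor : ∀ j m j' m' r0 η → (∀ r → r < ℚ[ m ] → LowerLin θ ρ j r) → ¬ LowerLin θ ρ j' r0 →
      r0 + η ≤ ℚ[ m' ℤ.+ + 1 ] → (ℚℕ j + ℚℕ j' + 1ℚ) * ε ≤ η →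
      ℚ[ m ] - ℚ[ m' ] - 1ℚ < (ℚℕ j - ℚℕ j') * T
    gap-bound-floor j m j' m' r0 η A B h3 h6 = diff-neg⇒< (subst (_< 0ℚ) ident sum<0)
      where
      rlt : ℚ[ m ] - ε < ℚ[ m ]
      rlt = subst₂ _<_ refl (solve 2 (λ a e → a :+ e :- e := a) refl ℚ[ m ] ε) (+-monoˡ-< (- ε) (subst (_< ℚ[ m ] + ε) (+-identityʳ ℚ[ m ]) (+-monoʳ-< ℚ[ m ] hε)))
      w = A (ℚ[ m ] - ε) rlt
      s = proj₁ w
      t = proj₁ (proj₂ w)
      Ls = proj₁ (proj₂ (proj₂ w))
      Lt = proj₁ (proj₂ (proj₂ (proj₂ w)))
      h1 = proj₂ (proj₂ (proj₂ (proj₂ w)))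
      lf = raise-witness s Ls
      s* = proj₁ lf
      Ls* = proj₁ (proj₂ lf)
      ss* = proj₁ (proj₂ (proj₂ lf))
      ls* = proj₂ (proj₂ (proj₂ lf))
      J = ℚℕ j
      J' = ℚℕ j'
      h1' : ℚ[ m ] - ε < J * s* + t
      h1' = <-≤-trans h1 (+-monoˡ-≤ t (scale-mono j ss*))
      h2 : J' * s* + t ≤ r0
      h2 = ≮⇒≥ (λ lt → B (s* , t , Ls* , Lt , lt))
      h4 : J * s* ≤ J * (T + ε)
      h4 = scale-mono j (below-upper s* Ls*)
      h5 : J' * (T - ε) ≤ J' * s*
      h5 = scale-mono j' ls*
      M' = ℚ[ m' ]
      h3' : r0 + η ≤ M' + 1ℚ
      h3' = subst (r0 + η ≤_) (sym (ℚ[]-+ m' (+ 1))) h3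
      sum<0 : ((ℚ[ m ] - ε) - (J * s* + t)) + ((J' * s* + t) - r0) + ((r0 + η) - (M' + 1ℚ))
              + (J * s* - J * (T + ε)) + (J' * (T - ε) - J' * s*) + ((J + J' + 1ℚ) * ε - η) < 0ℚ
      sum<0 = +-mono-<-≤ (+-mono-<-≤ (+-mono-<-≤ (+-mono-<-≤ (+-mono-<-≤ (<⇒diff-neg h1') (≤⇒diff-nonpos h2)) (≤⇒diff-nonpos h3')) (≤⇒diff-nonpos h4)) (≤⇒diff-nonpos h5)) (≤⇒diff-nonpos h6)
      ident : ((ℚ[ m ] - ε) - (J * s* + t)) + ((J' * s* + t) - r0) + ((r0 + η) - (M' + 1ℚ))
              + (J * s* - J * (T + ε)) + (J' * (T - ε) - J' * s*) + ((J + J' + 1ℚ) * ε - η)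
              ≡ (ℚ[ m ] - M' - 1ℚ) - (J - J') * T
      ident = solve 10 (λ M e J s t J' r0 η M' T →
                ((M :- e) :- (J :* s :+ t)) :+ ((J' :* s :+ t) :- r0) :+ ((r0 :+ η) :- (M' :+ con 1ℚ))
                :+ (J :* s :- J :* (T :+ e)) :+ (J' :* (T :- e) :- J' :* s) :+ ((J :+ J' :+ con 1ℚ) :* e :- η)
                := (M :- M' :- con 1ℚ) :- (J :- J') :* T) refl ℚ[ m ] ε J s* t J' r0 η M' T

    gap-bound-ceil : ∀ j M j' M' η (s t : ℚ) → L θ s → L ρ t → ℚ[ M ℤ.- + 1 ] + η ≤ ℚℕ j * s + t →
      (∀ r → LowerLin θ ρ j' r → r < ℚ[ M' ]) → (ℚℕ j + ℚℕ j') * ε ≤ η →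
      ℚ[ M ℤ.- + 1 ] - ℚ[ M' ℤ.- + 1 ] - 1ℚ < (ℚℕ j - ℚℕ j') * T
    gap-bound-ceil j M j' M' η s t Ls Lt hA0 B h6 = diff-neg⇒< (subst (_< 0ℚ) ident sum<0)
      where
      lf = raise-witness s Ls
      s* = proj₁ lf
      Ls* = proj₁ (proj₂ lf)
      ss* = proj₁ (proj₂ (proj₂ lf))
      ls* = proj₂ (proj₂ (proj₂ lf))
      J = ℚℕ j
      J' = ℚℕ j'
      ℓ = ℚ[ M ℤ.- + 1 ]
      ℓ' = ℚ[ M' ℤ.- + 1 ]
      hA : ℓ + η ≤ J * s* + t
      hA = ≤-trans hA0 (+-monoˡ-≤ t (scale-mono j ss*))
      rt = rounded ρ t Lt
      t'' = proj₁ rt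
      hB0 : J' * s* + t < ℚ[ M' ]
      hB0 = B (J' * s* + t) (s* , t'' , Ls* , proj₂ (proj₂ rt) , +-monoʳ-< (J' * s*) (proj₁ (proj₂ rt)))
      eM : ℚ[ M' ] ≡ ℓ' + 1ℚ
      eM = trans (cong ℚ[_] (sym e)) (sym (ℚ[]-+ (M' ℤ.- + 1) (+ 1)))
        where
        open import Data.Integer.Solver using () renaming (module +-*-Solver to ZS)
        e : M' ℤ.- + 1 ℤ.+ + 1 ≡ M'
        e = ZS.solve 1 (λ x → x ZS.:- ZS.con (+ 1) ZS.:+ ZS.con (+ 1) ZS.:= x) refl M'
      hB : J' * s* + t < ℓ' + 1ℚ
      hB = subst (J' * s* + t <_) eM hB0
      h4 : J * s* ≤ J * (T + ε)
      h4 = scale-mono j (below-upper s* Ls*)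
      h5 : J' * (T - ε) ≤ J' * s*
      h5 = scale-mono j' ls*
      sum<0 : ((ℓ + η) - (J * s* + t)) + ((J' * s* + t) - (ℓ' + 1ℚ))
              + (J * s* - J * (T + ε)) + (J' * (T - ε) - J' * s*) + ((J + J') * ε - η) < 0ℚ
      sum<0 = +-mono-<-≤ (+-mono-<-≤ (+-mono-<-≤ (+-mono-≤-< (≤⇒diff-nonpos hA) (<⇒diff-neg hB)) (≤⇒diff-nonpos h4)) (≤⇒diff-nonpos h5)) (≤⇒diff-nonpos h6)
      ident : ((ℓ + η) - (J * s* + t)) + ((J' * s* + t) - (ℓ' + 1ℚ))
              + (J * s* - J * (T + ε)) + (J' * (T - ε) - J' * s*) + ((J + J') * ε - η)
              ≡ (ℓ - ℓ' - 1ℚ) - (J - J') * T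
      ident = solve 9 (λ l η J s t J' l' T e →
                ((l :+ η) :- (J :* s :+ t)) :+ ((J' :* s :+ t) :- (l' :+ con 1ℚ))
                :+ (J :* s :- J :* (T :+ e)) :+ (J' :* (T :- e) :- J' :* s) :+ ((J :+ J') :* e :- η)
                := (l :- l' :- con 1ℚ) :- (J :- J') :* T) refl ℓ η J s* t J' ℓ' T ε


module SmallErrors where

  open IntegerEmbedding
  open import Data.Nat as ℕ using (ℕ; zero; suc; NonZero; z≤n; s≤s)
  import Data.Nat.Properties as NP
  open import Data.Integer as ℤ using (ℤ; +_)
  import Data.Integer.Properties as ℤP
  open import Data.Rational as ℚ using (ℚ; mkℚ; _/_; 1ℚ; 0ℚ; _<_; _≤_; _+_; _*_; _⊓_; 1/_)
  open import Data.Rational.Properties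
  open import Relation.Binary.PropositionalEquality hiding (J)
  open import Data.Product using (∃; _×_; _,_; proj₁; proj₂)
  open import Data.Sum using (_⊎_; inj₁; inj₂)
  open import Data.Bool using (Bool; true; false)
  open import Data.Rational.Unnormalised as ℚᵘ using (*≤*)
  import Data.Rational.Unnormalised.Properties as ℚᵘP

  ⊓-pos : ∀ {x y} → 0ℚ < x → 0ℚ < y → 0ℚ < x ⊓ y
  ⊓-pos {x} {y} hx hy with ⊓-sel x y
  ... | inj₁ e = subst (0ℚ <_) (sym e) hx
  ... | inj₂ e = subst (0ℚ <_) (sym e) hy

  0<1 : 0ℚ < 1ℚ
  0<1 = positive⁻¹ 1ℚ

  min-of-positives : ∀ (f : ℕ → Bool → ℚ) n → (∀ t b → t ℕ.< n → 0ℚ < f t b) →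
    ∃ λ η → 0ℚ < η × (∀ t b → t ℕ.< n → η ≤ f t b)
  min-of-positives f zero h = 1ℚ , 0<1 , λ t b ()
  min-of-positives f (suc n) h with min-of-positives f n (λ t b lt → h t b (NP.m<n⇒m<1+n lt))
  ... | η0 , p0 , b0 = η , pos , bnd
    where
    η = η0 ⊓ (f n true ⊓ f n false)
    pos : 0ℚ < η
    pos = ⊓-pos p0 (⊓-pos (h n true NP.≤-refl) (h n false NP.≤-refl))
    bnd : ∀ t b → t ℕ.< suc n → η ≤ f t b
    bnd t b lt with NP.m<1+n⇒m<n∨m≡n lt
    ... | inj₁ lt' = ≤-trans (p⊓q≤p η0 _) (b0 t b lt')
    ... | inj₂ refl with b
    ...   | true = ≤-trans (p⊓q≤q η0 _) (p⊓q≤p (f t true) (f t false))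
    ...   | false = ≤-trans (p⊓q≤q η0 _) (p⊓q≤q (f t true) (f t false))

  ℚ[]-mono-≤ : ∀ {a b} → a ℤ.≤ b → ℚ[ a ] ≤ ℚ[ b ]
  ℚ[]-mono-≤ {a} {b} h = toℚᵘ-cancel-≤ (ℚᵘP.≤-respʳ-≃ (ℚᵘP.≃-sym (toℚᵘ-ℚ[] b)) (ℚᵘP.≤-respˡ-≃ (ℚᵘP.≃-sym (toℚᵘ-ℚ[] a))
    (*≤* (subst₂ ℤ._≤_ (sym (ℤP.*-identityʳ a)) (sym (ℤP.*-identityʳ b)) h))))

  ℚℕ-mono : ∀ {a b} → a ℕ.≤ b → ℚℕ a ≤ ℚℕ b
  ℚℕ-mono h = ℚ[]-mono-≤ (ℤ.+≤+ h)

  module SmallEpsilon (D0 : ℕ) (η : ℚ) (hη : 0ℚ < η) where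
    open import Data.Nat.Coprimality using (Coprime; 1-coprimeTo)
    import Data.Nat.Coprimality as Cop
    cop : Coprime (suc D0) 1
    cop = Cop.sym (1-coprimeTo (suc D0))
    Dq : ℚ
    Dq = mkℚ (+ suc D0) 0 cop
    Dq≡ : ℚℕ (suc D0) ≡ Dq
    Dq≡ = normalize-coprime cop
    ε : ℚ
    ε = η * (1/ Dq)
    instance
      posη : ℚ.Positive η
      posη = ℚ.positive hη
    hε : 0ℚ < ε
    hε = positive⁻¹ ε {{pos*pos⇒pos η (1/ Dq)}}
    Dε : Dq * ε ≡ η
    Dε = trans (sym (*-assoc Dq η (1/ Dq))) (trans (cong (_* (1/ Dq)) (*-comm Dq η))
           (trans (*-assoc η Dq (1/ Dq)) (trans (cong (η *_) (*-inverseʳ Dq)) (*-identityʳ η))))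
    ε-small : ∀ x → x ≤ ℚℕ (suc D0) → x * ε ≤ η
    ε-small x h = subst (x * ε ≤_) Dε (*-monoʳ-≤-nonNeg ε {{ℚ.nonNegative (<⇒≤ hε)}} (subst (x ≤_) Dq≡ h))

  ℚℕ-sum : ∀ j j' → ℚℕ j + ℚℕ j' + 1ℚ ≡ ℚℕ (j ℕ.+ j' ℕ.+ 1)
  ℚℕ-sum j j' = trans (cong (_+ 1ℚ) (ℚ[]-+ (+ j) (+ j'))) (ℚ[]-+ (+ (j ℕ.+ j')) (+ 1))


module IntegerIntercept where

  open FloorArithmetic using (floor-unique)
  open import Data.Nat as ℕ using (ℕ; zero; suc; NonZero; z≤n; s≤s)
  import Data.Nat.Properties as NP
  open import Data.Nat.DivMod using (_/_)
  open import Data.Integer as ℤ using (ℤ; +_; -[1+_]; _⊖_; +≤+)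
  open import Data.Integer.Properties
  open import Relation.Binary.PropositionalEquality
  open import Data.Product using (∃; _×_; _,_; proj₁; proj₂)
  open import Data.Sum using (_⊎_; inj₁; inj₂)
  open import Data.Bool using (Bool; true; false)
  open import Data.Empty using (⊥-elim)
  open import Data.Integer.Solver using (module +-*-Solver)
  open +-*-Solver

  floor-from-bounds : ∀ (Z : ℤ) (x q : ℕ) .{{_ : NonZero q}} → Z ℤ.* + q ℤ.≤ + x → + x ℤ.< Z ℤ.* + q ℤ.+ + q → + (x / q) ≡ Z
  floor-from-bounds (+ z) x q h1 h2 = cong +_ (floor-unique x q z l1 l2)
    where
    l1 : q ℕ.* z ℕ.≤ x
    l1 = subst (ℕ._≤ x) (NP.*-comm z q) (drop‿+≤+ (subst (ℤ._≤ + x) (sym (pos-* z q)) h1))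
    l2 : x ℕ.< q ℕ.* suc z
    l2 = subst (x ℕ.<_) (trans (NP.+-comm (z ℕ.* q) q) (trans (cong (q ℕ.+_) (NP.*-comm z q)) (sym (NP.*-suc q z))))
           (drop‿+<+ (subst (+ x ℤ.<_) (trans (cong (ℤ._+ + q) (sym (pos-* z q))) (sym (pos-+ (z ℕ.* q) q))) h2))
  floor-from-bounds -[1+ z ] x q h1 h2 = ⊥-elim (<-irrefl refl (<-≤-trans h5 (0⊖m≤+ z {0})))
    where
    Z = -[1+ z ]
    e : Z ℤ.* + q ℤ.+ + q ≡ (Z ℤ.+ + 1) ℤ.* + q
    e = solve 2 (λ Z q → Z :* q :+ q := (Z :+ con (+ 1)) :* q) refl Z (+ q)
    h3 : + 0 ℤ.* + q ℤ.< (Z ℤ.+ + 1) ℤ.* + q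
    h3 = ≤-<-trans (+≤+ z≤n) (subst (+ x ℤ.<_) e h2)
    h4 : + 0 ℤ.< Z ℤ.+ + 1
    h4 = *-cancelʳ-<-nonNeg (+ q) h3
    h5 : + 0 ℤ.< 0 ⊖ z
    h5 = subst (+ 0 ℤ.<_) ([1+m]⊖[1+n]≡m⊖n 0 z) h4

  gap⇒offset-bound : ∀ ℓ ℓ' j j' p q → (ℓ ℤ.- ℓ' ℤ.- + 1) ℤ.* + q ℤ.< (+ j ℤ.- + j') ℤ.* + p →
    ℓ ℤ.* + q ℤ.- + j ℤ.* + p ℤ.< (ℓ' ℤ.* + q ℤ.- + j' ℤ.* + p) ℤ.+ + q
  gap⇒offset-bound ℓ ℓ' j j' p q h = subst₂ ℤ._<_ (sym ident) (+-identityʳ _) (+-monoʳ-< ((ℓ' ℤ.* + q ℤ.- + j' ℤ.* + p) ℤ.+ + q) xy)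
    where
    X = (ℓ ℤ.- ℓ' ℤ.- + 1) ℤ.* + q
    Y = (+ j ℤ.- + j') ℤ.* + p
    xy : X ℤ.- Y ℤ.< + 0
    xy = subst (X ℤ.- Y ℤ.<_) (+-inverseʳ Y) (+-monoˡ-< (ℤ.- Y) h)
    ident : ℓ ℤ.* + q ℤ.- + j ℤ.* + p ≡ ((ℓ' ℤ.* + q ℤ.- + j' ℤ.* + p) ℤ.+ + q) ℤ.+ (X ℤ.- Y)
    ident = solve 6 (λ l l' J J' P Q → l :* Q :- J :* P := ((l' :* Q :- J' :* P) :+ Q) :+ ((l :- l' :- con (+ 1)) :* Q :- (J :- J') :* P))
              refl ℓ ℓ' (+ j) (+ j') (+ p) (+ q)

  max₂ : ∀ x y → ∃ λ C → x ℤ.≤ C × y ℤ.≤ C × (C ≡ x ⊎ C ≡ y)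
  max₂ x y with ≤-total x y
  ... | inj₁ h = y , h , ≤-refl , inj₂ refl
  ... | inj₂ h = x , ≤-refl , h , inj₁ refl

  max-over-window : ∀ (Lf : ℕ → Bool → ℤ) n → ∃ λ C → (∀ t b → t ℕ.< suc n → Lf t b ℤ.≤ C) × ∃ λ t0 → ∃ λ b0 → t0 ℕ.< suc n × C ≡ Lf t0 b0
  max-over-window Lf zero with max₂ (Lf 0 true) (Lf 0 false)
  ... | C , h1 , h2 , at = C , bnd , 0 , proj₁ (pickB at) , s≤s z≤n , proj₂ (pickB at)
    where
    pickB : ∀ {C t} → (C ≡ Lf t true ⊎ C ≡ Lf t false) → ∃ λ b → C ≡ Lf t b
    pickB (inj₁ e) = true , e
    pickB (inj₂ e) = false , e
    bnd : ∀ t b → t ℕ.< 1 → Lf t b ℤ.≤ C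
    bnd zero true _ = h1
    bnd zero false _ = h2
    bnd (suc t) b (s≤s ())
  max-over-window Lf (suc n) with max-over-window Lf n | max₂ (Lf (suc n) true) (Lf (suc n) false)
  ... | C0 , b0 , t0 , bb0 , lt0 , e0 | C1 , h1 , h2 , at1 with max₂ C0 C1
  ...   | C , g0 , g1 , at = C , bnd , att at
    where
    pickB : ∀ {C t} → (C ≡ Lf t true ⊎ C ≡ Lf t false) → ∃ λ b → C ≡ Lf t b
    pickB (inj₁ e) = true , e
    pickB (inj₂ e) = false , e
    bnd : ∀ t b → t ℕ.< suc (suc n) → Lf t b ℤ.≤ C
    bnd t b lt with NP.m<1+n⇒m<n∨m≡n lt
    ... | inj₁ lt' = ≤-trans (b0 t b lt') g0
    ... | inj₂ refl with b
    ...   | true = ≤-trans h1 g1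
    ...   | false = ≤-trans h2 g1
    att : (C ≡ C0 ⊎ C ≡ C1) → ∃ λ t0 → ∃ λ b0 → t0 ℕ.< suc (suc n) × C ≡ Lf t0 b0
    att (inj₁ e) = t0 , bb0 , NP.m<n⇒m<1+n lt0 , trans e e0
    att (inj₂ e) = suc n , proj₁ (pickB at1) , NP.≤-refl , trans e (proj₂ (pickB at1))

  lift-nonneg : ∀ (C : ℤ) q → 1 ℕ.≤ q → ∃ λ N → ∃ λ c → + c ≡ C ℤ.+ + N ℤ.* + q
  lift-nonneg (+ c0) q _ = 0 , c0 , trans (sym (+-identityʳ (+ c0))) (cong (λ z → + c0 ℤ.+ z) (sym (*-zeroˡ (+ q))))
  lift-nonneg -[1+ c0 ] (suc q0) _ = suc c0 , suc c0 ℕ.* q0 , trans (pos-* (suc c0) q0) (trans e (cong (λ z → -[1+ c0 ] ℤ.+ + suc c0 ℤ.* z) (sym (pos-+ 1 q0))))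
    where
    e : + suc c0 ℤ.* + q0 ≡ ℤ.- (+ suc c0) ℤ.+ + suc c0 ℤ.* (+ 1 ℤ.+ + q0)
    e = solve 2 (λ A B → A :* B := :- A :+ A :* (con (+ 1) :+ B)) refl (+ suc c0) (+ q0)

  floor-of-intercept : ∀ (ℓ C : ℤ) (N c j p q : ℕ) .{{_ : NonZero q}} → + c ≡ C ℤ.+ + N ℤ.* + q →
    ℓ ℤ.* + q ℤ.- + j ℤ.* + p ℤ.≤ C → C ℤ.< (ℓ ℤ.* + q ℤ.- + j ℤ.* + p) ℤ.+ + q →
    + ((c ℕ.+ j ℕ.* p) / q) ≡ ℓ ℤ.+ + N
  floor-of-intercept ℓ C N c j p q ec h1 h2 = floor-from-bounds (ℓ ℤ.+ + N) (c ℕ.+ j ℕ.* p) q l1 l2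
    where
    W = + N ℤ.* + q ℤ.+ + j ℤ.* + p
    ex : + (c ℕ.+ j ℕ.* p) ≡ C ℤ.+ W
    ex = trans (pos-+ c (j ℕ.* p)) (trans (cong₂ ℤ._+_ ec (pos-* j p)) (+-assoc C (+ N ℤ.* + q) (+ j ℤ.* + p)))
    l1 : (ℓ ℤ.+ + N) ℤ.* + q ℤ.≤ + (c ℕ.+ j ℕ.* p)
    l1 = subst₂ ℤ._≤_ (solve 5 (λ l Q J P N → (l :* Q :- J :* P) :+ (N :* Q :+ J :* P) := (l :+ N) :* Q) refl ℓ (+ q) (+ j) (+ p) (+ N)) (sym ex) (+-monoˡ-≤ W h1)
    l2 : + (c ℕ.+ j ℕ.* p) ℤ.< (ℓ ℤ.+ + N) ℤ.* + q ℤ.+ + q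
    l2 = subst₂ ℤ._<_ (sym ex) (solve 5 (λ l Q J P N → ((l :* Q :- J :* P) :+ Q) :+ (N :* Q :+ J :* P) := (l :+ N) :* Q :+ Q) refl ℓ (+ q) (+ j) (+ p) (+ N)) (+-monoˡ-< W h2)

  -- If the integers L_t = ℓ_t q − j_t p (t ranging over a finite window, each position
  -- carrying two values) are pairwise less than q apart, then one intercept c ≥ 0
  -- reproduces all ℓ_t up to a common shift: ⌊(c + j_t p)/q⌋ = ℓ_t + N.
  -- Take C = max L_t, so that L_t ≤ C < L_t + q, and lift C to c = C + Nq ≥ 0.
  intercept-from-gaps : ∀ (ℓ : ℕ → Bool → ℤ) (j : ℕ → Bool → ℕ) (p q n : ℕ) .{{_ : NonZero q}} → 1 ℕ.≤ q →
    (∀ t b t′ b′ → t ℕ.< n → t′ ℕ.< n →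
      ℓ t b ℤ.* + q ℤ.- + j t b ℤ.* + p ℤ.< (ℓ t′ b′ ℤ.* + q ℤ.- + j t′ b′ ℤ.* + p) ℤ.+ + q) →
    ∃ λ c → ∃ λ N → ∀ t b → t ℕ.< n → + ((c ℕ.+ j t b ℕ.* p) / q) ≡ ℓ t b ℤ.+ + N
  intercept-from-gaps ℓ j p q zero _ _ = 0 , 0 , λ t b ()
  intercept-from-gaps ℓ j p q (suc n) q≥1 gaps with max-over-window (λ t b → ℓ t b ℤ.* + q ℤ.- + j t b ℤ.* + p) n
  ... | C , below-C , t₀ , b₀ , t₀<n , C≡ with lift-nonneg C q q≥1
  ...   | N , c , c≡ = c , N , λ t b t<n →
    floor-of-intercept (ℓ t b) C N c (j t b) p q c≡ (below-C t b t<n)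
      (subst (ℤ._< (ℓ t b ℤ.* + q ℤ.- + j t b ℤ.* + p) ℤ.+ + q) (sym C≡) (gaps t₀ b₀ t b t₀<n t<n))


module RationalApproximation where

  open IntegerEmbedding
  open SmallErrors
  open IntegerIntercept
  open import Data.Nat as ℕ using (ℕ; suc; NonZero; s≤s; _<_)
  import Data.Nat.Properties as NP
  open import Data.Integer as ℤ using (ℤ; +_)
  open import Data.Rational as ℚ using (ℚ; 1ℚ; 0ℚ; _+_; _*_; _-_)
  open import Relation.Binary.PropositionalEquality hiding (J)
  open import Relation.Nullary using (¬_)
  open import Data.Product using (∃; _×_; _,_; proj₁; proj₂)
  open import Data.Bool using (Bool; true; false)

  -- The data of a window: positions t < n, each with two indices j (b = true, false),
  -- integer values ℓ and positive margins; pair-gaps turns any ε-approximation T of θ,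
  -- ε small against the margins, into the gap condition for T.
  module Window (a b : ℕ) (d : ℕ → ℕ) (hd : PositiveQuotients d) (θ : ℝ) (cf : IsCF θ d) (n i : ℕ)
    (index : ℕ → Bool → ℕ) (floorVal : ℕ → Bool → ℤ) (margin : ℕ → Bool → ℚ)
    (margin-pos : ∀ t b → t < n → 0ℚ ℚ.< margin t b)
    (index-bound′ : ∀ t b → t < n → index t b ℕ.≤ i ℕ.+ n)
    (pair-gaps : ∀ T ε θu → 0ℚ ℚ.< ε → L θ (T - ε) → ¬ L θ θu → θu ℚ.< T + ε → ∀ η →
        (∀ t b → t < n → η ℚ.≤ margin t b) →
        (∀ t b t' b' → t < n → t' < n → (ℚℕ (index t b) + ℚℕ (index t' b') + 1ℚ) * ε ℚ.≤ η) →
        ∀ t b t' b' → t < n → t' < n → ℚ[ floorVal t b ] - ℚ[ floorVal t' b' ] - 1ℚ ℚ.< (ℚℕ (index t b) - ℚℕ (index t' b')) * T)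
    where
    open StandardJumpWords a b d hd using (double; m≤double; nzq; rotation)

    Gaps : ℚ → Set
    Gaps T = ∀ t b t′ b′ → t < n → t′ < n →
      ℚ[ floorVal t b ] - ℚ[ floorVal t′ b′ ] - 1ℚ ℚ.< (ℚℕ (index t b) - ℚℕ (index t′ b′)) * T

    -- Some convergent p_K/q_K with K = 2m + 1 > k satisfies the gap condition: take ε
    -- small compared with the least margin η divided by the window size, and K so large
    -- that θ is ε-close to p_K/q_K.
    good-convergent : (k : ℕ) → ∃ λ m → k ℕ.≤ double m × Gaps (convergent d (suc (double m)))
    good-convergent k = m , k≤2m , pair-gaps T ε θu hε θ>T-ε θ≮θu θu<T+ε η η-least ε-fits
      where
      least = min-of-positives margin n margin-pos
      η = proj₁ least
      η-least = proj₂ (proj₂ least)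
      J = i ℕ.+ n
      open SmallEpsilon (J ℕ.+ J) η (proj₁ (proj₂ least))
      ε-fits : ∀ t b t′ b′ → t < n → t′ < n → (ℚℕ (index t b) + ℚℕ (index t′ b′) + 1ℚ) * ε ℚ.≤ η
      ε-fits t b t′ b′ lt lt′ = ε-small _ (subst (ℚ._≤ ℚℕ (suc (J ℕ.+ J))) (sym (ℚℕ-sum (index t b) (index t′ b′)))
        (ℚℕ-mono (subst (ℕ._≤ suc (J ℕ.+ J)) (NP.+-comm 1 _) (s≤s (NP.+-mono-≤ (index-bound′ t b lt) (index-bound′ t′ b′ lt′))))))
      K₀ = proj₁ (cf ε hε)
      m = K₀ ℕ.+ k
      k≤2m : k ℕ.≤ double m
      k≤2m = NP.≤-trans (NP.m≤n+m k K₀) (m≤double m)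
      K = suc (double m)
      K₀≤K : K₀ ℕ.≤ K
      K₀≤K = NP.≤-trans (NP.m≤m+n K₀ k) (NP.≤-trans (m≤double m) (NP.n≤1+n _))
      close = proj₂ (cf ε hε) K K₀≤K
      T = convergent d K
      θ>T-ε = proj₁ close
      θu = proj₁ (proj₂ close)
      θu<T+ε = proj₁ (proj₂ (proj₂ close))
      θ≮θu = proj₂ (proj₂ (proj₂ close))

    integer-gaps : ∀ K → Gaps (convergent d K) → ∀ t b t′ b′ → t < n → t′ < n →
      floorVal t b ℤ.* + qc d K ℤ.- + index t b ℤ.* + pc d K
        ℤ.< (floorVal t′ b′ ℤ.* + qc d K ℤ.- + index t′ b′ ℤ.* + pc d K) ℤ.+ + qc d K
    integer-gaps K gaps t b t′ b′ lt lt′ =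
      gap⇒offset-bound (floorVal t b) (floorVal t′ b′) (index t b) (index t′ b′) (pc d K) (qc d K)
        (<-cross-multiply (floorVal t b ℤ.- floorVal t′ b′ ℤ.- + 1) (+ index t b ℤ.- + index t′ b′) (pc d K) (qc d K) {{nzq K}}
          (subst₂ ℚ._<_ ℓ-diff (cong (_* convergent d K) (ℚ[]-- (+ index t b) (+ index t′ b′))) (gaps t b t′ b′ lt lt′)))
      where
      ℓ-diff : ℚ[ floorVal t b ] - ℚ[ floorVal t′ b′ ] - 1ℚ ≡ ℚ[ floorVal t b ℤ.- floorVal t′ b′ ℤ.- + 1 ]
      ℓ-diff = trans (cong (_- 1ℚ) (ℚ[]-- (floorVal t b) (floorVal t′ b′))) (ℚ[]-- (floorVal t b ℤ.- floorVal t′ b′) (+ 1))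

    common-intercept : (k : ℕ) → ∃ λ m → k ℕ.≤ double m × ∃ λ c → ∃ λ N →
      ∀ t b → t < n → + rotation (suc (double m)) c (index t b) ≡ floorVal t b ℤ.+ + N
    common-intercept k = m , k≤2m , intercept-from-gaps floorVal index (pc d K) (qc d K) n {{nzq K}} (qc-pos d K)
                                       (integer-gaps K (proj₂ (proj₂ chosen)))
      where
      chosen = good-convergent k
      m = proj₁ chosen
      k≤2m = proj₁ (proj₂ chosen)
      K = suc (double m)

module SturmianWindows (a b : ℕ) (d : ℕ → ℕ) (hd : PositiveQuotients d) (θ : ℝ) (cf : IsCF θ d) (s : ℕ → ℕ) where

  open IntegerEmbedding
  open SlopeApproximation
  open RationalApproximation
  open StandardJumpWords a b d hd using (double; rotation)
  open JumpWords a b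
  open import Data.Nat as ℕ using (zero; suc; z≤n; s≤s; _<_; _∸_)
  import Data.Nat.Properties as NP
  open import Data.List using (_∷_)
  open import Data.Integer as ℤ using (ℤ; +_)
  import Data.Integer.Properties as ℤP
  open import Data.Rational as ℚ using (ℚ; 1ℚ; 0ℚ; _+_; _*_; _-_)
  import Data.Rational.Properties as ℚP
  open import Relation.Binary.PropositionalEquality
  open import Relation.Nullary using (¬_)
  open import Data.Product using (∃; _×_; _,_; proj₁; proj₂)
  open import Data.Sum using (inj₁; inj₂)
  open import Data.Bool using (Bool; true; false)
  open import Data.Rational.Solver using () renaming (module +-*-Solver to QS)

  RotationWindow : ℕ → ℕ → ℕ → Set
  RotationWindow i n k = ∃ λ m → k ℕ.≤ double m × ∃ λ c → window s i n ≡ jumpWord (rotation (suc (double m)) c) i n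

  -- The letter s_{i+t+1} compares the values at the indices i+t+1 (true) and i+t (false).
  index : ℕ → ℕ → Bool → ℕ
  index i t true = suc (i ℕ.+ t)
  index i t false = i ℕ.+ t

  index-bound : ∀ i n t b → t < n → index i t b ℕ.≤ i ℕ.+ n
  index-bound i n t true lt = subst (ℕ._≤ i ℕ.+ n) (NP.+-suc i t) (NP.+-monoʳ-≤ i lt)
  index-bound i n t false lt = NP.≤-trans (NP.n≤1+n _) (index-bound i n t true lt)

  window-as-jumpWord : ∀ f i n → (∀ t → t < n → s (suc (i ℕ.+ t)) ≡ letter a b (+ f (suc (i ℕ.+ t))) (+ f (i ℕ.+ t))) →
    window s i n ≡ jumpWord f i n
  window-as-jumpWord f i zero _ = refl
  window-as-jumpWord f i (suc n) letters = cong₂ _∷_ first (window-as-jumpWord f (suc i) n rest)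
    where
    first : s (suc i) ≡ letter a b (+ f (suc i)) (+ f i)
    first = subst (λ z → s (suc z) ≡ letter a b (+ f (suc z)) (+ f z)) (NP.+-identityʳ i) (letters 0 (s≤s z≤n))
    rest : ∀ t → t < n → s (suc (suc i ℕ.+ t)) ≡ letter a b (+ f (suc (suc i ℕ.+ t))) (+ f (suc i ℕ.+ t))
    rest t lt = subst (λ z → s (suc z) ≡ letter a b (+ f (suc z)) (+ f z)) (NP.+-suc i t) (letters (suc t) (s≤s lt))

  -- If the window's letters compare the values v, and v agrees with a rotation up to
  -- a common shift Z, then the window is a rotation window (letters ignore shifts).
  from-values : ∀ i n k (v : ℕ → Bool → ℤ) →
    (∀ t → t < n → s (suc (i ℕ.+ t)) ≡ letter a b (v t true) (v t false)) →
    (∃ λ m → k ℕ.≤ double m × ∃ λ c → ∃ λ Z → ∀ t b → t < n → + rotation (suc (double m)) c (index i t b) ≡ v t b ℤ.+ Z) →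
    RotationWindow i n k
  from-values i n k v letters (m , k≤2m , c , Z , agree) = m , k≤2m , c , window-as-jumpWord (rotation (suc (double m)) c) i n
    (λ t lt → trans (letters t lt) (trans (sym (letter-shift (v t true) (v t false) Z))
                (cong₂ (letter a b) (sym (agree t true lt)) (sym (agree t false lt)))))

  -- Lower mechanical words: the values are ℓ = ⌊jθ + ρ⌋, with margin (ℓ + 1) − r₀ where
  -- r₀ < ℓ + 1 is a rational upper bound for jθ + ρ.
  module Lower (ρ : ℝ) (mech : IsLowerMechanical a b θ ρ s) (i n : ℕ) where
    at : (t : ℕ) → ∃ λ m → ∃ λ m′ → FloorLinIs θ ρ (suc (i ℕ.+ t)) m × FloorLinIs θ ρ (suc (i ℕ.+ t) ∸ 1) m′ × s (suc (i ℕ.+ t)) ≡ letter a b m m′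
    at t = mech (suc (i ℕ.+ t)) (s≤s z≤n)
    floorVal : ℕ → Bool → ℤ
    floorVal t true = proj₁ (at t)
    floorVal t false = proj₁ (proj₂ (at t))
    floor-at : ∀ t b → FloorLinIs θ ρ (index i t b) (floorVal t b)
    floor-at t true = proj₁ (proj₂ (proj₂ (at t)))
    floor-at t false = proj₁ (proj₂ (proj₂ (proj₂ (at t))))
    r₀ : ℕ → Bool → ℚ
    r₀ t b = proj₁ (proj₂ (floor-at t b))
    margin : ℕ → Bool → ℚ
    margin t b = ℚ[ floorVal t b ℤ.+ + 1 ] - r₀ t b
    margin-pos : ∀ t b → t < n → 0ℚ ℚ.< margin t b
    margin-pos t b _ = <⇒diff-pos (proj₁ (proj₂ (proj₂ (floor-at t b))))
    pair-gaps : ∀ T ε θu → 0ℚ ℚ.< ε → L θ (T - ε) → ¬ L θ θu → θu ℚ.< T + ε → ∀ η →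
      (∀ t b → t < n → η ℚ.≤ margin t b) →
      (∀ t b t′ b′ → t < n → t′ < n → (ℚℕ (index i t b) + ℚℕ (index i t′ b′) + 1ℚ) * ε ℚ.≤ η) →
      ∀ t b t′ b′ → t < n → t′ < n → ℚ[ floorVal t b ] - ℚ[ floorVal t′ b′ ] - 1ℚ ℚ.< (ℚℕ (index i t b) - ℚℕ (index i t′ b′)) * T
    pair-gaps T ε θu hε θ>T-ε θ≮θu θu<T+ε η η-least ε-fits t b t′ b′ lt lt′ =
      CloseToConvergent.gap-bound-floor θ ρ T ε θu hε θ>T-ε θ≮θu θu<T+ε (index i t b) (floorVal t b) (index i t′ b′) (floorVal t′ b′) (r₀ t′ b′) η
        (proj₁ (floor-at t b)) (proj₂ (proj₂ (proj₂ (floor-at t′ b′)))) r₀+η≤ (ε-fits t b t′ b′ lt lt′)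
      where
      X = ℚ[ floorVal t′ b′ ℤ.+ + 1 ]
      r₀+η≤ : r₀ t′ b′ + η ℚ.≤ X
      r₀+η≤ = subst (r₀ t′ b′ + η ℚ.≤_) (QS.solve 2 (λ r x → r QS.:+ (x QS.:- r) QS.:= x) refl (r₀ t′ b′) X)
                (ℚP.+-monoʳ-≤ (r₀ t′ b′) (η-least t′ b′ lt′))
    rotation-window : ∀ k → RotationWindow i n k
    rotation-window k =
      let m , k≤2m , c , N , agree = Window.common-intercept a b d hd θ cf n i (index i) floorVal margin margin-pos (index-bound i n) pair-gaps k
      in from-values i n k floorVal (λ t _ → proj₂ (proj₂ (proj₂ (proj₂ (at t))))) (m , k≤2m , c , + N , agree)

  -- Upper mechanical words: the values are M = ⌈jθ + ρ⌉, compared through ℓ = M − 1,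
  -- with margin jθ + ρ − ℓ witnessed by rationals s < θ and t < ρ.
  module Upper (ρ : ℝ) (mech : IsUpperMechanical a b θ ρ s) (i n : ℕ) where
    at : (t : ℕ) → ∃ λ m → ∃ λ m′ → CeilLinIs θ ρ (suc (i ℕ.+ t)) m × CeilLinIs θ ρ (suc (i ℕ.+ t) ∸ 1) m′ × s (suc (i ℕ.+ t)) ≡ letter a b m m′
    at t = mech (suc (i ℕ.+ t)) (s≤s z≤n)
    ceilVal : ℕ → Bool → ℤ
    ceilVal t true = proj₁ (at t)
    ceilVal t false = proj₁ (proj₂ (at t))
    floorVal : ℕ → Bool → ℤ
    floorVal t b = ceilVal t b ℤ.- + 1
    ceil-at : ∀ t b → CeilLinIs θ ρ (index i t b) (ceilVal t b)
    ceil-at t true = proj₁ (proj₂ (proj₂ (at t)))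
    ceil-at t false = proj₁ (proj₂ (proj₂ (proj₂ (at t))))
    sA tA : ℕ → Bool → ℚ
    sA t b = proj₁ (proj₁ (ceil-at t b))
    tA t b = proj₁ (proj₂ (proj₁ (ceil-at t b)))
    XA : ℕ → Bool → ℚ
    XA t b = ℚℕ (index i t b) * sA t b + tA t b
    margin : ℕ → Bool → ℚ
    margin t b = XA t b - ℚ[ floorVal t b ]
    margin-pos : ∀ t b → t < n → 0ℚ ℚ.< margin t b
    margin-pos t b _ = <⇒diff-pos (proj₂ (proj₂ (proj₂ (proj₂ (proj₁ (ceil-at t b))))))
    pair-gaps : ∀ T ε θu → 0ℚ ℚ.< ε → L θ (T - ε) → ¬ L θ θu → θu ℚ.< T + ε → ∀ η →
      (∀ t b → t < n → η ℚ.≤ margin t b) →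
      (∀ t b t′ b′ → t < n → t′ < n → (ℚℕ (index i t b) + ℚℕ (index i t′ b′) + 1ℚ) * ε ℚ.≤ η) →
      ∀ t b t′ b′ → t < n → t′ < n → ℚ[ floorVal t b ] - ℚ[ floorVal t′ b′ ] - 1ℚ ℚ.< (ℚℕ (index i t b) - ℚℕ (index i t′ b′)) * T
    pair-gaps T ε θu hε θ>T-ε θ≮θu θu<T+ε η η-least ε-fits t b t′ b′ lt lt′ =
      CloseToConvergent.gap-bound-ceil θ ρ T ε θu hε θ>T-ε θ≮θu θu<T+ε (index i t b) (ceilVal t b) (index i t′ b′) (ceilVal t′ b′) η (sA t b) (tA t b)
        (proj₁ (proj₂ (proj₂ (proj₁ (ceil-at t b))))) (proj₁ (proj₂ (proj₂ (proj₂ (proj₁ (ceil-at t b))))))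
        ℓ+η≤ (proj₂ (ceil-at t′ b′)) Sε≤η
      where
      ℓ = ℚ[ floorVal t b ]
      ℓ+η≤ : ℓ + η ℚ.≤ XA t b
      ℓ+η≤ = subst (ℓ + η ℚ.≤_) (QS.solve 2 (λ l x → l QS.:+ (x QS.:- l) QS.:= x) refl ℓ (XA t b)) (ℚP.+-monoʳ-≤ ℓ (η-least t b lt))
      S = ℚℕ (index i t b) + ℚℕ (index i t′ b′)
      Sε≤η : S * ε ℚ.≤ η
      Sε≤η = ℚP.≤-trans (ℚP.*-monoʳ-≤-nonNeg ε {{ℚ.nonNegative (ℚP.<⇒≤ hε)}}
               (subst (ℚ._≤ S + 1ℚ) (ℚP.+-identityʳ S) (ℚP.+-monoʳ-≤ S (ℚP.<⇒≤ (ℚP.positive⁻¹ 1ℚ)))))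
               (ε-fits t b t′ b′ lt lt′)
    rotation-window : ∀ k → RotationWindow i n k
    rotation-window k =
      let m , k≤2m , c , N , agree = Window.common-intercept a b d hd θ cf n i (index i) floorVal margin margin-pos (index-bound i n) pair-gaps k
      in from-values i n k ceilVal (λ t _ → proj₂ (proj₂ (proj₂ (proj₂ (at t)))))
           (m , k≤2m , c , ℤ.- + 1 ℤ.+ + N , λ t b lt → trans (agree t b lt) (ℤP.+-assoc (ceilVal t b) (ℤ.- + 1) (+ N)))

  window-is-rotation-window : IsSturmian a b θ s → ∀ i n k → RotationWindow i n k
  window-is-rotation-window (ρ , _ , _ , inj₁ mech) i n k = Lower.rotation-window ρ mech i n k
  window-is-rotation-window (ρ , _ , _ , inj₂ mech) i n k = Upper.rotation-window ρ mech i n k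

open import Data.Nat using (suc; _≤_; _<_; _∸_; z≤n; s≤s)
open import Data.Nat.Properties using (≤-trans; <⇒≤)
open import Data.List using (List; length; _++_)
open import Data.Product using (∃; _×_; _,_; proj₁; proj₂)
open import Data.Sum using (_⊎_)
open import Relation.Binary.PropositionalEquality using (_≡_; _≢_; sym; trans; cong; subst; subst₂)
open import Data.Rational using (0ℚ; 1ℚ)
open WordFacts using (factor-trans)

lemma2p1 : (a b : ℕ) → 0 < a → 0 < b → a ≢ b →
    (d : ℕ → ℕ) → (∀ k → 1 ≤ k → 1 ≤ d k) →
    (θ : ℝ) → 0ℚ <ℝ θ → θ ℝ< 1ℚ → Irrational θ → IsCF θ d →
    (s : ℕ → ℕ) → IsSturmian a b θ s →
    (k n : ℕ) → (M : List ℕ) → FactorOfInf M s → length M ≡ n →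
    qc d k ≤ n → n < qc d (suc k) →
    (∃ λ j → 1 ≤ j × FactorOf M ((Mw a b d (suc k) ^w j) ++ Mw a b d k))
    ⊎ (∃ λ U → ∃ λ V → M ≡ U ++ V × SuffixOf U (Mw a b d (suc (suc k)))
    × PrefixOf V (Mw a b d (suc (suc k))) × qc d k ∸ 1 ≤ length V)
lemma2p1 a b _ _ _ d hd θ _ _ _ cf s sturmian k n M (i , M≡window) |M|≡n _ n<qₖ₊₁ =
  factor-of-blocks block-word (proj₁ M-in-W) M (proj₁ (proj₂ M-in-W)) (proj₂ (proj₂ M-in-W)) |M|<|A|
  where
  open StandardWords a b d using (module Blocks; length-M)
  open Blocks k (hd (suc k) (s≤s z≤n))
  open StandardJumpWords a b d hd using (q-mono-≤; module SquareFactors)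
  open SturmianWindows a b d hd θ cf s using (window-is-rotation-window)

  rotation = window-is-rotation-window sturmian i n k
  m = proj₁ rotation
  k≤2m = proj₁ (proj₂ rotation)
  c = proj₁ (proj₂ (proj₂ rotation))
  open SquareFactors m using (K; jump-window-in-square)
  Mᴷ = Mw a b d (suc K)

  -- Hence M is a factor of M_K M_K, as n < q_{k+1} ≤ q_K.
  M-in-square : FactorOf M (Mᴷ ++ Mᴷ)
  M-in-square = subst (λ w → FactorOf w (Mᴷ ++ Mᴷ))
    (sym (trans M≡window (trans (cong (window s i) |M|≡n) (proj₂ (proj₂ (proj₂ rotation))))))
    (jump-window-in-square c i n (≤-trans (<⇒≤ n<qₖ₊₁) (q-mono-≤ (s≤s k≤2m))))

  square = standard-square-in-blocks (hd (suc (suc k)) (s≤s z≤n)) (suc K) (s≤s (s≤s k≤2m))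
  W = proj₁ square
  block-word = proj₁ (proj₂ square)
  M-in-W = factor-trans M (Mᴷ ++ Mᴷ) W M-in-square (proj₂ (proj₂ square))

  |M|<|A| : length M < length A
  |M|<|A| = subst₂ _<_ (sym |M|≡n) (sym (length-M (suc k))) n<qₖ₊₁
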